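{- For every integer $n\ge 0$, the following identity of polynomials in $x$ holds: \[ \sum_{k=0}^{n}E_{k}(x)E_{n-k}(x)=-\frac{8}{n+2}\sum_{k=0}^{n}\left(2^{k+1}k+2^{k}\right)\left\{\sum_{l=0}^{n}\sum_{\substack{0\le j\le l\\ j-k\equiv 0 \pmod 2}}\binom{n+2}{l}\binom{l}{j}E_{n-l+1}B_{l-j}\frac{j!\left(\frac{j+k+2}{2}\right)!}{\left(\frac{j-k}{2}\right)!\,(j+k+2)!}\right\}P_{k}(x). \]
   Context: $P_k(x)$ denotes the $k$-th Legendre polynomial, defined by $\frac{1}{\sqrt{1-2xt+t^2}}=\sum_{k\ge 0}P_k(x)t^k$ (equivalently $P_k(x)=\frac{1}{k!2^k}\frac{d^k}{dx^k}(x^2-1)^k$). The Euler polynomials $E_n(x)$ are defined by $\frac{2}{e^t+1}e^{xt}=\sum_{n\ge0}E_n(x)\frac{t^n}{n!}$, and $E_m:=E_m(0)$. The Bernoulli polynomials $B_n(x)$ are defined by $\frac{t}{e^t-1}e^{xt}=\sum_{n\ge0}B_n(x)\frac{t^n}{n!}$, and $B_m:=B_m(0)$. Convention: terms with $j<k$ are taken to be $0$, i.e. $1/m!=0$ for negative integers $m$. -}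

module Defs where

open import Data.Nat as ℕ using (ℕ; zero; suc; _∸_; _!; _≤?_)
open import Data.Nat.Combinatorics using (_C_)
open import Data.Integer using (+_)
open import Data.Rational using (ℚ; 0ℚ; 1ℚ; _+_; _*_; _-_; -_; _/_)
open import Relation.Nullary using (yes; no)
open import Data.Bool using (if_then_else_)

ℕ→ℚ : ℕ → ℚ
ℕ→ℚ n = (+ n) / 1

-- the rational number a / b (only ever used with b ≠ 0; returns 0 for b = 0)
_÷ℕ_ : ℕ → ℕ → ℚ
a ÷ℕ zero    = 0ℚ
a ÷ℕ (suc b) = (+ a) / suc b

sumTo : ℕ → (ℕ → ℚ) → ℚ
sumTo zero    f = f 0
sumTo (suc n) f = sumTo n f + f (suc n)

sumBelow : ℕ → (ℕ → ℚ) → ℚ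
sumBelow zero    = λ f → 0ℚ
sumBelow (suc n) = sumTo n

_^_ : ℚ → ℕ → ℚ
x ^ zero  = 1ℚ
x ^ suc n = x * (x ^ n)

half : ℚ
half = 1 ÷ℕ 2

-- Bernoulli numbers B_m = B_m(0) from t/(e^t-1) = Σ B_m t^m/m!
-- Coefficient comparison in t = (e^t - 1)·Σ B_m t^m/m! gives
-- B_0 = 1 and Σ_{k=0}^{m} C(m+1,k) B_k = 0 for m ≥ 1, i.e.
-- B_m = -(1/(m+1)) Σ_{k<m} C(m+1,k) B_k.   (So B_1 = -1/2.)
bernoulliList : ℕ → (ℕ → ℚ)
bernoulliList zero    k = 1ℚ
bernoulliList (suc m) k with k ≤? m
... | yes _ = bernoulliList m k
... | no  _ = - ((1 ÷ℕ (suc m ℕ.+ 1)) *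
                 sumBelow (suc m) (λ i → ℕ→ℚ ((suc m ℕ.+ 1) C i) * bernoulliList m i))

B : ℕ → ℚ
B m = bernoulliList m m

-- Euler numbers E_m = E_m(0) from 2/(e^t+1) = Σ E_m t^m/m!
-- Coefficient comparison in 2 = (e^t + 1)·Σ E_m t^m/m! gives
-- E_0 = 1 and E_m = -(1/2) Σ_{k<m} C(m,k) E_k for m ≥ 1.
eulerList : ℕ → (ℕ → ℚ)
eulerList zero    k = 1ℚ
eulerList (suc m) k with k ≤? m
... | yes _ = eulerList m k
... | no  _ = - (half * sumBelow (suc m) (λ i → ℕ→ℚ (suc m C i) * eulerList m i))

E : ℕ → ℚ
E m = eulerList m m

-- Euler polynomials: 2e^{xt}/(e^t+1) = (Σ E_k t^k/k!)·e^{xt}, hence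
-- E_n(x) = Σ_{k=0}^{n} C(n,k) E_k x^{n-k}
Epoly : ℕ → ℚ → ℚ
Epoly n x = sumTo n (λ k → ℕ→ℚ (n C k) * E k * (x ^ (n ∸ k)))

-- Legendre polynomials via Rodrigues' formula
-- P_k(x) = (1/(k! 2^k)) d^k/dx^k (x^2-1)^k.  Expanding
-- (x^2-1)^k = Σ_i C(k,i) (-1)^{k-i} x^{2i} and differentiating k times:
-- P_k(x) = (1/2^k) Σ_{i=0}^{k} C(k,i) (-1)^{k-i} [2i ≥ k] (2i)!/((2i-k)! k!) x^{2i-k}
-- (the factor (2i)!/((2i-k)! k!) = C(2i,k)).
P : ℕ → ℚ → ℚ
P k x = (1 ÷ℕ (2 ℕ.^ k)) *
  sumTo k (λ i → if does (k ≤? (2 ℕ.* i))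
     then ℕ→ℚ (k C i) * ((- 1ℚ) ^ (k ∸ i)) * ℕ→ℚ ((2 ℕ.* i) C k) * (x ^ ((2 ℕ.* i) ∸ k))
     else 0ℚ)
  where open import Relation.Nullary using (does)

{-# OPTIONS --safe #-}
module Submission where

-- With Q_k = 2^k P_k, the weight (2^{k+1} k + 2^k) P_k equals (2k+1) Q_k, and
-- x^j / 2 = Σ_k (2k+1) W_{j,k} Q_k(x) for the coefficients W_{j,k} of the statement.
-- This follows by induction on j: multiplying by x and applying Bonnet's recurrence
-- 2(2k+1) x Q_k = (k+1) Q_{k+1} + 4k Q_{k-1} gives the sum for j+1, because
-- 2(2k+1) W_{j+1,k} = k W_{j,k-1} + 4(k+1) W_{j,k+1}.
-- Substituting this expansion, the right-hand side becomes
--   R_n(x) = -8/(n+2) Σ_l Σ_{j≤l} C(n+2,l) C(l,j) E_{n-l+1} B_{l-j} x^j / 2.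
-- Both the convolution Σ_k E_k(x) E_{n-k}(x) and R_n have the Appell shape
-- Σ_i C(n+1,i+1) a_i x^{n-i}: the convolution by Vandermonde's identity, R_n by
-- C(n+2,l) C(l,j) = C(n+2,j) C(n+2-j,l-j).  For both, the value at x = 1 exceeds the
-- value at x = 0 by -4 E_n (using E_k(1) = -E_k for k ≥ 1, and Σ_i C(l,i) B_i = B_l + [l = 1]),
-- and these increments determine the constants a_i, since Σ_{i≤t} C(t+2,i+1) a_i = -4 E_{t+1}
-- is a triangular system with nonzero diagonal C(t+2,t+1) = t+2.

module Binomial where

  open import Data.Nat
  open import Data.Nat.Properties
  open import Data.Nat.Combinatorics
  open import Data.Nat.DivMod using (m/n*n≡m)
  open import Relation.Binary.PropositionalEquality
  open import Relation.Nullary using (yes; no)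
  import Data.Nat.Tactic.RingSolver as ℕ-Solver

  nCk*k!*[n∸k]!≡n! : ∀ {n k} → k ≤ n → (n C k) * (k ! * (n ∸ k) !) ≡ n !
  nCk*k!*[n∸k]!≡n! {n} {k} k≤n = trans (cong (_* (k ! * (n ∸ k) !)) (nCk≡n!/k![n-k]! k≤n))
    (m/n*n≡m {{k !* (n ∸ k) !≢0}} (k![n∸k]!∣n! k≤n))

  [k+1]*[n+1]C[k+1]≡[n+1]*nCk : ∀ n k → suc k * (suc n C suc k) ≡ suc n * (n C k)
  [k+1]*[n+1]C[k+1]≡[n+1]*nCk n k with k ≤? n
  ... | no k≰n rewrite k>n⇒nCk≡0 (s≤s (≰⇒> k≰n)) | k>n⇒nCk≡0 (≰⇒> k≰n) =
    trans (*-zeroʳ (suc k)) (sym (*-zeroʳ (suc n)))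
  ... | yes k≤n = *-cancelʳ-≡ _ _ (k ! * (n ∸ k) !) {{k !* (n ∸ k) !≢0}} (begin
    suc k * (suc n C suc k) * (k ! * (n ∸ k) !)    ≡⟨ regroup (suc k) (suc n C suc k) (k !) ((n ∸ k) !) ⟩
    (suc n C suc k) * (suc k ! * (n ∸ k) !)        ≡⟨ nCk*k!*[n∸k]!≡n! (s≤s k≤n) ⟩
    suc n * n !                                    ≡⟨ cong (suc n *_) (nCk*k!*[n∸k]!≡n! k≤n) ⟨
    suc n * ((n C k) * (k ! * (n ∸ k) !))          ≡⟨ *-assoc (suc n) (n C k) _ ⟨
    suc n * (n C k) * (k ! * (n ∸ k) !)            ∎)
    where
    open ≡-Reasoning
    regroup : ∀ a c f g → a * c * (f * g) ≡ c * (a * f * g)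
    regroup = ℕ-Solver.solve-∀

  [k+1]*nC[k+1]≡[n∸k]*nCk : ∀ n k → suc k * (n C suc k) ≡ (n ∸ k) * (n C k)
  [k+1]*nC[k+1]≡[n∸k]*nCk n k with suc k ≤? n
  ... | no k≮n rewrite k>n⇒nCk≡0 (≰⇒> k≮n) | m≤n⇒m∸n≡0 (≤-pred (≰⇒> k≮n)) = *-zeroʳ (suc k)
  ... | yes k<n = *-cancelʳ-≡ _ _ (k ! * (n ∸ suc k) !) {{k !* (n ∸ suc k) !≢0}} (begin
    suc k * (n C suc k) * (k ! * (n ∸ suc k) !)          ≡⟨ regroup (suc k) (n C suc k) (k !) ((n ∸ suc k) !) ⟩
    (n C suc k) * (suc k ! * (n ∸ suc k) !)              ≡⟨ nCk*k!*[n∸k]!≡n! k<n ⟩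
    n !                                                  ≡⟨ nCk*k!*[n∸k]!≡n! (<⇒≤ k<n) ⟨
    (n C k) * (k ! * (n ∸ k) !)                          ≡⟨ cong (λ m → (n C k) * (k ! * m !)) n∸k≡1+n∸[k+1] ⟩
    (n C k) * (k ! * (suc (n ∸ suc k) * (n ∸ suc k) !))  ≡⟨ regroup′ (n C k) (k !) (n ∸ suc k) ((n ∸ suc k) !) ⟩
    suc (n ∸ suc k) * (n C k) * (k ! * (n ∸ suc k) !)    ≡⟨ cong (λ m → m * (n C k) * (k ! * (n ∸ suc k) !)) n∸k≡1+n∸[k+1] ⟨
    (n ∸ k) * (n C k) * (k ! * (n ∸ suc k) !)            ∎)
    where
    open ≡-Reasoning
    n∸k≡1+n∸[k+1] : n ∸ k ≡ suc (n ∸ suc k)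
    n∸k≡1+n∸[k+1] = +-∸-assoc 1 k<n
    regroup : ∀ a c f g → a * c * (f * g) ≡ c * (a * f * g)
    regroup = ℕ-Solver.solve-∀
    regroup′ : ∀ c f d g → c * (f * (suc d * g)) ≡ suc d * c * (f * g)
    regroup′ = ℕ-Solver.solve-∀

  [n+1∸k]*[n+1]Ck≡[n+1]*nCk : ∀ n k → (suc n ∸ k) * (suc n C k) ≡ suc n * (n C k)
  [n+1∸k]*[n+1]Ck≡[n+1]*nCk n k = trans (sym ([k+1]*nC[k+1]≡[n∸k]*nCk (suc n) k)) ([k+1]*[n+1]C[k+1]≡[n+1]*nCk n k)

  nCl*lCj≡nCj*[n∸j]C[l∸j] : ∀ n l j → j ≤ l → (n C l) * (l C j) ≡ (n C j) * ((n ∸ j) C (l ∸ j))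
  nCl*lCj≡nCj*[n∸j]C[l∸j] n l j j≤l with l ≤? n
  ... | no l≰n rewrite k>n⇒nCk≡0 (≰⇒> l≰n) = sym rhs≡0
    where
    rhs≡0 : (n C j) * ((n ∸ j) C (l ∸ j)) ≡ 0
    rhs≡0 with j ≤? n
    ... | yes j≤n rewrite k>n⇒nCk≡0 (∸-monoˡ-< (≰⇒> l≰n) j≤n) = *-zeroʳ (n C j)
    ... | no j≰n  rewrite k>n⇒nCk≡0 (≰⇒> j≰n) = refl
  ... | yes l≤n = *-cancelʳ-≡ _ _ D {{D≢0}} (begin
    (n C l) * (l C j) * D                                      ≡⟨ regroup (n C l) (l C j) (j !) ((l ∸ j) !) ((n ∸ l) !) ⟩
    (n C l) * ((l C j) * (j ! * (l ∸ j) !) * (n ∸ l) !)        ≡⟨ cong (λ m → (n C l) * (m * (n ∸ l) !)) (nCk*k!*[n∸k]!≡n! j≤l) ⟩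
    (n C l) * (l ! * (n ∸ l) !)                                ≡⟨ nCk*k!*[n∸k]!≡n! l≤n ⟩
    n !                                                        ≡⟨ nCk*k!*[n∸k]!≡n! (≤-trans j≤l l≤n) ⟨
    (n C j) * (j ! * (n ∸ j) !)                                ≡⟨ cong (λ m → (n C j) * (j ! * m)) (nCk*k!*[n∸k]!≡n! l∸j≤n∸j) ⟨
    (n C j) * (j ! * (((n ∸ j) C (l ∸ j)) * ((l ∸ j) ! * ((n ∸ j) ∸ (l ∸ j)) !)))
       ≡⟨ cong (λ m → (n C j) * (j ! * (((n ∸ j) C (l ∸ j)) * ((l ∸ j) ! * m !)))) [n∸j]∸[l∸j]≡n∸l ⟩
    (n C j) * (j ! * (((n ∸ j) C (l ∸ j)) * ((l ∸ j) ! * (n ∸ l) !)))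
       ≡⟨ regroup′ (n C j) ((n ∸ j) C (l ∸ j)) (j !) ((l ∸ j) !) ((n ∸ l) !) ⟩
    (n C j) * ((n ∸ j) C (l ∸ j)) * D                          ∎)
    where
    open ≡-Reasoning
    D = j ! * (l ∸ j) ! * (n ∸ l) !
    D≢0 : NonZero D
    D≢0 = m*n≢0 (j ! * (l ∸ j) !) ((n ∸ l) !) {{j !* (l ∸ j) !≢0}} {{(n ∸ l) !≢0}}
    l∸j≤n∸j : l ∸ j ≤ n ∸ j
    l∸j≤n∸j = ∸-monoˡ-≤ j l≤n
    [n∸j]∸[l∸j]≡n∸l : (n ∸ j) ∸ (l ∸ j) ≡ n ∸ l
    [n∸j]∸[l∸j]≡n∸l = trans (∸-+-assoc n j (l ∸ j)) (cong (n ∸_) (m+[n∸m]≡n j≤l))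
    regroup : ∀ a b f g h → a * b * (f * g * h) ≡ a * (b * (f * g) * h)
    regroup = ℕ-Solver.solve-∀
    regroup′ : ∀ a b f g h → a * (f * (b * (g * h))) ≡ a * b * (f * g * h)
    regroup′ = ℕ-Solver.solve-∀

  bonnet-coefficients : ∀ K i →
    2 * (2 * K + 3) * ((suc K C i) * ((2 * i) C suc K)) + 4 * suc K * ((K C i) * ((2 * i) C K))
    ≡ suc (suc K) * ((suc (suc K) C suc i) * (suc (suc (2 * i)) C suc (suc K)))
  bonnet-coefficients K i = begin
    2 * (2 * K + 3) * (X * Y₁) + 4 * suc K * (Ck * Y₀)
      ≡⟨ split K X Y₀ Y₁ Ck ⟩
    2 * (suc (suc K) * X) * Y₁ + (2 * X * (suc K * Y₁) + 4 * Y₀ * (suc K * Ck))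
      ≡⟨ cong₂ (λ p q → 2 * (suc (suc K) * X) * Y₁ + (2 * X * p + 4 * Y₀ * q))
               ([k+1]*nC[k+1]≡[n∸k]*nCk (2 * i) K) (sym ([n+1∸k]*[n+1]Ck≡[n+1]*nCk K i)) ⟩
    2 * (suc (suc K) * X) * Y₁ + (2 * X * ((2 * i ∸ K) * Y₀) + 4 * Y₀ * ((suc K ∸ i) * X))
      ≡⟨ cong (2 * (suc (suc K) * X) * Y₁ +_) (collect X Y₀ (2 * i ∸ K) (suc K ∸ i)) ⟩
    2 * (suc (suc K) * X) * Y₁ + 2 * ((2 * i ∸ K + 2 * (suc K ∸ i)) * (X * Y₀))
      ≡⟨ cong (λ m → 2 * (suc (suc K) * X) * Y₁ + 2 * m) weight ⟩
    2 * (suc (suc K) * X) * Y₁ + 2 * (suc (suc K) * (X * Y₀))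
      ≡⟨ combine (suc (suc K)) X Y₀ Y₁ ⟩
    2 * (suc (suc K) * X) * (Y₀ + Y₁)
      ≡⟨ cong (2 * (suc (suc K) * X) *_) (nCk+nC[k+1]≡[n+1]C[k+1] (2 * i) K) ⟩
    2 * (suc (suc K) * X) * (suc (2 * i) C suc K)
      ≡⟨ cong (λ m → 2 * m * (suc (2 * i) C suc K)) ([k+1]*[n+1]C[k+1]≡[n+1]*nCk (suc K) i) ⟨
    2 * (suc i * A) * (suc (2 * i) C suc K)
      ≡⟨ double i A (suc (2 * i) C suc K) ⟩
    A * (suc (suc (2 * i)) * (suc (2 * i) C suc K))
      ≡⟨ cong (A *_) ([k+1]*[n+1]C[k+1]≡[n+1]*nCk (suc (2 * i)) (suc K)) ⟨
    A * (suc (suc K) * B)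
      ≡⟨ *-comm A _ ⟩
    suc (suc K) * B * A
      ≡⟨ swap (suc (suc K)) A B ⟩
    suc (suc K) * (A * B) ∎
    where
    open ≡-Reasoning
    X = suc K C i
    Ck = K C i
    Y₀ = (2 * i) C K
    Y₁ = (2 * i) C suc K
    A = suc (suc K) C suc i
    B = suc (suc (2 * i)) C suc (suc K)
    split : ∀ K X Y₀ Y₁ Ck → 2 * (2 * K + 3) * (X * Y₁) + 4 * suc K * (Ck * Y₀)
      ≡ 2 * (suc (suc K) * X) * Y₁ + (2 * X * (suc K * Y₁) + 4 * Y₀ * (suc K * Ck))
    split = ℕ-Solver.solve-∀
    collect : ∀ X Y₀ d e → 2 * X * (d * Y₀) + 4 * Y₀ * (e * X) ≡ 2 * ((d + 2 * e) * (X * Y₀))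
    collect = ℕ-Solver.solve-∀
    combine : ∀ k X Y₀ Y₁ → 2 * (k * X) * Y₁ + 2 * (k * (X * Y₀)) ≡ 2 * (k * X) * (Y₀ + Y₁)
    combine = ℕ-Solver.solve-∀
    double : ∀ i A C → 2 * (suc i * A) * C ≡ A * (suc (suc (2 * i)) * C)
    double = ℕ-Solver.solve-∀
    swap : ∀ k A B → k * B * A ≡ k * (A * B)
    swap = ℕ-Solver.solve-∀
    annihilated : ∀ a b {c} → c ≡ 0 → a * c ≡ b * c
    annihilated a b refl = trans (*-zeroʳ a) (sym (*-zeroʳ b))
    weight : (2 * i ∸ K + 2 * (suc K ∸ i)) * (X * Y₀) ≡ suc (suc K) * (X * Y₀)
    weight with K ≤? 2 * i | i ≤? suc K
    ... | no K≰2i | _       = annihilated (2 * i ∸ K + 2 * (suc K ∸ i)) (suc (suc K))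
                                (trans (cong (X *_) (k>n⇒nCk≡0 (≰⇒> K≰2i))) (*-zeroʳ X))
    ... | yes _ | no i≰K+1 = annihilated (2 * i ∸ K + 2 * (suc K ∸ i)) (suc (suc K)) (cong (_* Y₀) (k>n⇒nCk≡0 (≰⇒> i≰K+1)))
    ... | yes K≤2i | yes i≤K+1 = cong (_* (X * Y₀)) (+-cancelʳ-≡ K _ _ (begin
      2 * i ∸ K + 2 * (suc K ∸ i) + K     ≡⟨ shuffle (2 * i ∸ K) (suc K ∸ i) K ⟩
      K + (2 * i ∸ K) + 2 * (suc K ∸ i)   ≡⟨ cong (_+ 2 * (suc K ∸ i)) (m+[n∸m]≡n K≤2i) ⟩
      2 * i + 2 * (suc K ∸ i)             ≡⟨ *-distribˡ-+ 2 i (suc K ∸ i) ⟨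
      2 * (i + (suc K ∸ i))               ≡⟨ cong (2 *_) (m+[n∸m]≡n i≤K+1) ⟩
      2 * suc K                           ≡⟨ twice K ⟩
      suc (suc K) + K                     ∎))
      where
      shuffle : ∀ d e K → d + 2 * e + K ≡ K + d + 2 * e
      shuffle = ℕ-Solver.solve-∀
      twice : ∀ K → 2 * suc K ≡ suc (suc K) + K
      twice = ℕ-Solver.solve-∀

open import Defs
open import Level using (0ℓ)
open import Data.Bool using (true; false; if_then_else_; _∧_)
open import Data.Empty using (⊥-elim)
open import Data.Product using (∃; _,_)
open import Data.Sum using (_⊎_; inj₁; inj₂; map₂; [_,_]′)
open import Data.Nat as ℕ using (ℕ; zero; suc; _∸_; _≤_; _<_; z≤n; s≤s; _≤?_; _!; _%_; _/_)
import Data.Nat.Properties as ℕP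
open import Data.Nat.Combinatorics using (_C_; k>n⇒nCk≡0; nCn≡1; nC1≡n; nCk≡nC[n∸k]; nCk+nC[k+1]≡[n+1]C[k+1])
open import Data.Nat.Coprimality using (1-coprimeTo) renaming (sym to coprime-sym)
open import Data.Nat.DivMod using (m*n/n≡m; m*n%n≡0; [m+kn]%n≡m%n)
import Data.Nat.Tactic.RingSolver as ℕ-Solver
import Data.Integer as ℤ
import Data.Integer.Properties as ℤP
open import Data.Rational using (ℚ; 0ℚ; 1ℚ; _+_; _*_; -_; _≟_; toℚᵘ)
open import Data.Rational.Properties as ℚP
  using (toℚᵘ-injective; toℚᵘ-homo-+; toℚᵘ-homo-*; toℚᵘ-fromℚᵘ; normalize-coprime; +-*-commutativeRing; +-0-group)
open import Algebra.Properties.Group ℚP.+-0-group using () renaming (∙-cancelˡ to +-cancelˡ)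
open import Data.Rational.Unnormalised as ℚᵘ using (*≡*; mkℚᵘ)
import Data.Rational.Unnormalised.Properties as ℚᵘP
open import Relation.Binary.PropositionalEquality
open import Relation.Nullary using (Dec; does; yes; no)
open import Relation.Nullary.Decidable using (dec-true; dec-false; dec⇒maybe)
open import Tactic.RingSolver using (solve-∀)
import Tactic.RingSolver.Core.AlmostCommutativeRing as ACR

open Binomial

ℚ-ring : ACR.AlmostCommutativeRing 0ℓ 0ℓ
ℚ-ring = ACR.fromCommutativeRing +-*-commutativeRing λ x → dec⇒maybe (0ℚ ≟ x)

ℕ→ℚ-toℚᵘ : ∀ n → toℚᵘ (ℕ→ℚ n) ℚᵘ.≃ mkℚᵘ (ℤ.+ n) 0
ℕ→ℚ-toℚᵘ n = ℚᵘP.≃-reflexive (cong toℚᵘ (normalize-coprime (coprime-sym (1-coprimeTo n))))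

ℕ→ℚ-homo-+ : ∀ m n → ℕ→ℚ (m ℕ.+ n) ≡ ℕ→ℚ m + ℕ→ℚ n
ℕ→ℚ-homo-+ m n = toℚᵘ-injective (begin
  toℚᵘ (ℕ→ℚ (m ℕ.+ n))                ≈⟨ ℕ→ℚ-toℚᵘ (m ℕ.+ n) ⟩
  mkℚᵘ (ℤ.+ (m ℕ.+ n)) 0               ≈⟨ *≡* numerators ⟩
  mkℚᵘ (ℤ.+ m) 0 ℚᵘ.+ mkℚᵘ (ℤ.+ n) 0   ≈⟨ ℚᵘP.+-cong (ℕ→ℚ-toℚᵘ m) (ℕ→ℚ-toℚᵘ n) ⟨
  toℚᵘ (ℕ→ℚ m) ℚᵘ.+ toℚᵘ (ℕ→ℚ n)       ≈⟨ toℚᵘ-homo-+ (ℕ→ℚ m) (ℕ→ℚ n) ⟨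
  toℚᵘ (ℕ→ℚ m + ℕ→ℚ n)                 ∎)
  where
  open ℚᵘP.≃-Reasoning
  numerators : ℤ.+ (m ℕ.+ n) ℤ.* ℤ.+ 1 ≡ (ℤ.+ m ℤ.* ℤ.+ 1 ℤ.+ ℤ.+ n ℤ.* ℤ.+ 1) ℤ.* ℤ.+ 1
  numerators = cong (ℤ._* ℤ.+ 1) (trans (ℤP.pos-+ m n)
    (sym (cong₂ ℤ._+_ (ℤP.*-identityʳ (ℤ.+ m)) (ℤP.*-identityʳ (ℤ.+ n)))))

ℕ→ℚ-homo-* : ∀ m n → ℕ→ℚ (m ℕ.* n) ≡ ℕ→ℚ m * ℕ→ℚ n
ℕ→ℚ-homo-* m n = toℚᵘ-injective (begin
  toℚᵘ (ℕ→ℚ (m ℕ.* n))                ≈⟨ ℕ→ℚ-toℚᵘ (m ℕ.* n) ⟩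
  mkℚᵘ (ℤ.+ (m ℕ.* n)) 0               ≈⟨ *≡* (cong (ℤ._* ℤ.+ 1) (ℤP.pos-* m n)) ⟩
  mkℚᵘ (ℤ.+ m) 0 ℚᵘ.* mkℚᵘ (ℤ.+ n) 0   ≈⟨ ℚᵘP.*-cong (ℕ→ℚ-toℚᵘ m) (ℕ→ℚ-toℚᵘ n) ⟨
  toℚᵘ (ℕ→ℚ m) ℚᵘ.* toℚᵘ (ℕ→ℚ n)       ≈⟨ toℚᵘ-homo-* (ℕ→ℚ m) (ℕ→ℚ n) ⟨
  toℚᵘ (ℕ→ℚ m * ℕ→ℚ n)                 ∎)
  where open ℚᵘP.≃-Reasoning

÷ℕ-*-cancel : ∀ a d → d ≢ 0 → (a ÷ℕ d) * ℕ→ℚ d ≡ ℕ→ℚ a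
÷ℕ-*-cancel a zero    d≢0 = ⊥-elim (d≢0 refl)
÷ℕ-*-cancel a (suc d) _   = toℚᵘ-injective (begin
  toℚᵘ ((a ÷ℕ suc d) * ℕ→ℚ (suc d))          ≈⟨ toℚᵘ-homo-* (a ÷ℕ suc d) (ℕ→ℚ (suc d)) ⟩
  toℚᵘ (a ÷ℕ suc d) ℚᵘ.* toℚᵘ (ℕ→ℚ (suc d))   ≈⟨ ℚᵘP.*-cong (toℚᵘ-fromℚᵘ (mkℚᵘ (ℤ.+ a) d)) (ℕ→ℚ-toℚᵘ (suc d)) ⟩
  mkℚᵘ (ℤ.+ a) d ℚᵘ.* mkℚᵘ (ℤ.+ suc d) 0      ≈⟨ *≡* (ℤP.*-assoc (ℤ.+ a) (ℤ.+ suc d) (ℤ.+ 1)) ⟩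
  mkℚᵘ (ℤ.+ a) 0                              ≈⟨ ℕ→ℚ-toℚᵘ a ⟨
  toℚᵘ (ℕ→ℚ a)                                ∎)
  where open ℚᵘP.≃-Reasoning

*-cancelʳ-ℕ→ℚ : ∀ {x y} d → d ≢ 0 → x * ℕ→ℚ d ≡ y * ℕ→ℚ d → x ≡ y
*-cancelʳ-ℕ→ℚ {x} {y} d d≢0 eq = begin
  x                      ≡⟨ undo x ⟨
  x * ℕ→ℚ d * (1 ÷ℕ d)   ≡⟨ cong (_* (1 ÷ℕ d)) eq ⟩
  y * ℕ→ℚ d * (1 ÷ℕ d)   ≡⟨ undo y ⟩
  y                      ∎
  where
  open ≡-Reasoning
  reassoc : ∀ z D u → z * D * u ≡ z * (u * D)
  reassoc = solve-∀ ℚ-ring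
  undo : ∀ z → z * ℕ→ℚ d * (1 ÷ℕ d) ≡ z
  undo z = trans (reassoc z (ℕ→ℚ d) (1 ÷ℕ d)) (trans (cong (z *_) (÷ℕ-*-cancel 1 d d≢0)) (ℚP.*-identityʳ z))

*-÷ℕ-clear : ∀ α N {D} → D ≢ 0 → ∀ E → ℕ→ℚ α * (N ÷ℕ D) * ℕ→ℚ (D ℕ.* E) ≡ ℕ→ℚ (α ℕ.* N ℕ.* E)
*-÷ℕ-clear α N {D} D≢0 E = begin
  ℕ→ℚ α * (N ÷ℕ D) * ℕ→ℚ (D ℕ.* E)          ≡⟨ cong (ℕ→ℚ α * (N ÷ℕ D) *_) (ℕ→ℚ-homo-* D E) ⟩
  ℕ→ℚ α * (N ÷ℕ D) * (ℕ→ℚ D * ℕ→ℚ E)        ≡⟨ reassoc (ℕ→ℚ α) (N ÷ℕ D) (ℕ→ℚ D) (ℕ→ℚ E) ⟩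
  ℕ→ℚ α * ((N ÷ℕ D) * ℕ→ℚ D) * ℕ→ℚ E        ≡⟨ cong (λ q → ℕ→ℚ α * q * ℕ→ℚ E) (÷ℕ-*-cancel N D D≢0) ⟩
  ℕ→ℚ α * ℕ→ℚ N * ℕ→ℚ E                     ≡⟨ cong (_* ℕ→ℚ E) (ℕ→ℚ-homo-* α N) ⟨
  ℕ→ℚ (α ℕ.* N) * ℕ→ℚ E                     ≡⟨ ℕ→ℚ-homo-* (α ℕ.* N) E ⟨
  ℕ→ℚ (α ℕ.* N ℕ.* E)                       ∎
  where
  open ≡-Reasoning
  reassoc : ∀ a u d e → a * u * (d * e) ≡ a * (u * d) * e
  reassoc = solve-∀ ℚ-ring

*-≢0 : ∀ {m n} → m ≢ 0 → n ≢ 0 → m ℕ.* n ≢ 0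
*-≢0 {m} m≢0 n≢0 mn≡0 = [ m≢0 , n≢0 ]′ (ℕP.m*n≡0⇒m≡0∨n≡0 m mn≡0)

cross-multiply₂ : ∀ α β N₁ N₂ {D₁ D₂} → D₁ ≢ 0 → D₂ ≢ 0 →
  α ℕ.* N₁ ℕ.* D₂ ≡ β ℕ.* N₂ ℕ.* D₁ → ℕ→ℚ α * (N₁ ÷ℕ D₁) ≡ ℕ→ℚ β * (N₂ ÷ℕ D₂)
cross-multiply₂ α β N₁ N₂ {D₁} {D₂} D₁≢0 D₂≢0 eq = *-cancelʳ-ℕ→ℚ (D₁ ℕ.* D₂) (*-≢0 D₁≢0 D₂≢0) (begin
  ℕ→ℚ α * (N₁ ÷ℕ D₁) * ℕ→ℚ (D₁ ℕ.* D₂)   ≡⟨ *-÷ℕ-clear α N₁ D₁≢0 D₂ ⟩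
  ℕ→ℚ (α ℕ.* N₁ ℕ.* D₂)                  ≡⟨ cong ℕ→ℚ eq ⟩
  ℕ→ℚ (β ℕ.* N₂ ℕ.* D₁)                  ≡⟨ *-÷ℕ-clear β N₂ D₂≢0 D₁ ⟨
  ℕ→ℚ β * (N₂ ÷ℕ D₂) * ℕ→ℚ (D₂ ℕ.* D₁)   ≡⟨ cong (λ D → ℕ→ℚ β * (N₂ ÷ℕ D₂) * ℕ→ℚ D) (ℕP.*-comm D₂ D₁) ⟩
  ℕ→ℚ β * (N₂ ÷ℕ D₂) * ℕ→ℚ (D₁ ℕ.* D₂)   ∎)
  where open ≡-Reasoning

cross-multiply₃ : ∀ α β γ N₁ N₂ N₃ {D₁ D₂ D₃} → D₁ ≢ 0 → D₂ ≢ 0 → D₃ ≢ 0 →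
  α ℕ.* N₁ ℕ.* (D₂ ℕ.* D₃) ≡ β ℕ.* N₂ ℕ.* (D₁ ℕ.* D₃) ℕ.+ γ ℕ.* N₃ ℕ.* (D₁ ℕ.* D₂) →
  ℕ→ℚ α * (N₁ ÷ℕ D₁) ≡ ℕ→ℚ β * (N₂ ÷ℕ D₂) + ℕ→ℚ γ * (N₃ ÷ℕ D₃)
cross-multiply₃ α β γ N₁ N₂ N₃ {D₁} {D₂} {D₃} D₁≢0 D₂≢0 D₃≢0 eq =
  *-cancelʳ-ℕ→ℚ D (*-≢0 D₁≢0 (*-≢0 D₂≢0 D₃≢0)) (begin
    ℕ→ℚ α * (N₁ ÷ℕ D₁) * ℕ→ℚ D                                    ≡⟨ *-÷ℕ-clear α N₁ D₁≢0 (D₂ ℕ.* D₃) ⟩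
    ℕ→ℚ (α ℕ.* N₁ ℕ.* (D₂ ℕ.* D₃))                                ≡⟨ cong ℕ→ℚ eq ⟩
    ℕ→ℚ (β ℕ.* N₂ ℕ.* (D₁ ℕ.* D₃) ℕ.+ γ ℕ.* N₃ ℕ.* (D₁ ℕ.* D₂))   ≡⟨ ℕ→ℚ-homo-+ (β ℕ.* N₂ ℕ.* (D₁ ℕ.* D₃)) (γ ℕ.* N₃ ℕ.* (D₁ ℕ.* D₂)) ⟩
    ℕ→ℚ (β ℕ.* N₂ ℕ.* (D₁ ℕ.* D₃)) + ℕ→ℚ (γ ℕ.* N₃ ℕ.* (D₁ ℕ.* D₂))
      ≡⟨ cong₂ _+_ (*-÷ℕ-clear β N₂ D₂≢0 (D₁ ℕ.* D₃)) (*-÷ℕ-clear γ N₃ D₃≢0 (D₁ ℕ.* D₂)) ⟨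
    ℕ→ℚ β * (N₂ ÷ℕ D₂) * ℕ→ℚ (D₂ ℕ.* (D₁ ℕ.* D₃)) + ℕ→ℚ γ * (N₃ ÷ℕ D₃) * ℕ→ℚ (D₃ ℕ.* (D₁ ℕ.* D₂))
      ≡⟨ cong₂ (λ D′ D″ → ℕ→ℚ β * (N₂ ÷ℕ D₂) * ℕ→ℚ D′ + ℕ→ℚ γ * (N₃ ÷ℕ D₃) * ℕ→ℚ D″)
               (permute₁ D₁ D₂ D₃) (permute₂ D₁ D₂ D₃) ⟩
    ℕ→ℚ β * (N₂ ÷ℕ D₂) * ℕ→ℚ D + ℕ→ℚ γ * (N₃ ÷ℕ D₃) * ℕ→ℚ D    ≡⟨ ℚP.*-distribʳ-+ (ℕ→ℚ D) (ℕ→ℚ β * (N₂ ÷ℕ D₂)) (ℕ→ℚ γ * (N₃ ÷ℕ D₃)) ⟨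
    (ℕ→ℚ β * (N₂ ÷ℕ D₂) + ℕ→ℚ γ * (N₃ ÷ℕ D₃)) * ℕ→ℚ D          ∎)
  where
  open ≡-Reasoning
  D = D₁ ℕ.* (D₂ ℕ.* D₃)
  permute₁ : ∀ a b c → b ℕ.* (a ℕ.* c) ≡ a ℕ.* (b ℕ.* c)
  permute₁ = ℕ-Solver.solve-∀
  permute₂ : ∀ a b c → c ℕ.* (a ℕ.* b) ≡ a ℕ.* (b ℕ.* c)
  permute₂ = ℕ-Solver.solve-∀

*-cong-unless-zero : ∀ c {p q} → c ≡ 0ℚ ⊎ p ≡ q → c * p ≡ c * q
*-cong-unless-zero c {p} {q} (inj₁ refl) = trans (ℚP.*-zeroˡ p) (sym (ℚP.*-zeroˡ q))
*-cong-unless-zero c         (inj₂ p≡q)  = cong (c *_) p≡q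

1^n≡1 : ∀ n → 1ℚ ^ n ≡ 1ℚ
1^n≡1 zero    = refl
1^n≡1 (suc n) = cong (1ℚ *_) (1^n≡1 n)

0^[1+n]≡0 : ∀ n → 0ℚ ^ suc n ≡ 0ℚ
0^[1+n]≡0 n = ℚP.*-zeroˡ (0ℚ ^ n)

^-distribˡ-+-* : ∀ x a b → x ^ (a ℕ.+ b) ≡ x ^ a * x ^ b
^-distribˡ-+-* x zero    b = sym (ℚP.*-identityˡ _)
^-distribˡ-+-* x (suc a) b = trans (cong (x *_) (^-distribˡ-+-* x a b)) (sym (ℚP.*-assoc x _ _))

-- Finite sums

sumTo-cong : ∀ n {f g : ℕ → ℚ} → (∀ k → f k ≡ g k) → sumTo n f ≡ sumTo n g
sumTo-cong zero    f≡g = f≡g 0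
sumTo-cong (suc n) f≡g = cong₂ _+_ (sumTo-cong n f≡g) (f≡g (suc n))

sumTo-cong≤ : ∀ n {f g : ℕ → ℚ} → (∀ k → k ≤ n → f k ≡ g k) → sumTo n f ≡ sumTo n g
sumTo-cong≤ zero    f≡g = f≡g 0 z≤n
sumTo-cong≤ (suc n) f≡g =
  cong₂ _+_ (sumTo-cong≤ n (λ k k≤n → f≡g k (ℕP.m≤n⇒m≤1+n k≤n))) (f≡g (suc n) ℕP.≤-refl)

sumTo-zero : ∀ n {f : ℕ → ℚ} → (∀ k → k ≤ n → f k ≡ 0ℚ) → sumTo n f ≡ 0ℚ
sumTo-zero zero    f≡0 = f≡0 0 z≤n
sumTo-zero (suc n) f≡0 =
  cong₂ _+_ (sumTo-zero n (λ k k≤n → f≡0 k (ℕP.m≤n⇒m≤1+n k≤n))) (f≡0 (suc n) ℕP.≤-refl)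

sumTo-+ : ∀ n (f g : ℕ → ℚ) → sumTo n (λ k → f k + g k) ≡ sumTo n f + sumTo n g
sumTo-+ zero    f g = refl
sumTo-+ (suc n) f g = trans (cong (_+ (f (suc n) + g (suc n))) (sumTo-+ n f g))
                            (interchange (sumTo n f) (sumTo n g) (f (suc n)) (g (suc n)))
  where
  interchange : ∀ a b c d → (a + b) + (c + d) ≡ (a + c) + (b + d)
  interchange = solve-∀ ℚ-ring

*-distribˡ-sumTo : ∀ n c (f : ℕ → ℚ) → c * sumTo n f ≡ sumTo n (λ k → c * f k)
*-distribˡ-sumTo zero    c f = refl
*-distribˡ-sumTo (suc n) c f =
  trans (ℚP.*-distribˡ-+ c (sumTo n f) (f (suc n))) (cong (_+ c * f (suc n)) (*-distribˡ-sumTo n c f))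

*-distribʳ-sumTo : ∀ n c (f : ℕ → ℚ) → sumTo n f * c ≡ sumTo n (λ k → f k * c)
*-distribʳ-sumTo n c f = trans (ℚP.*-comm (sumTo n f) c)
  (trans (*-distribˡ-sumTo n c f) (sumTo-cong n (λ k → ℚP.*-comm c (f k))))

sumTo-*-sumTo : ∀ n m (f g : ℕ → ℚ) → sumTo n f * sumTo m g ≡ sumTo n (λ a → sumTo m (λ b → f a * g b))
sumTo-*-sumTo n m f g =
  trans (*-distribʳ-sumTo n (sumTo m g) f) (sumTo-cong n (λ a → *-distribˡ-sumTo m (f a) g))

sumTo-swap : ∀ n m (f : ℕ → ℕ → ℚ) →
  sumTo n (λ a → sumTo m (λ b → f a b)) ≡ sumTo m (λ b → sumTo n (λ a → f a b))
sumTo-swap zero    m f = refl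
sumTo-swap (suc n) m f = trans (cong (_+ sumTo m (f (suc n))) (sumTo-swap n m f))
  (sym (sumTo-+ m (λ b → sumTo n (λ a → f a b)) (f (suc n))))

sumTo-sucˡ : ∀ n (f : ℕ → ℚ) → sumTo (suc n) f ≡ f 0 + sumTo n (λ k → f (suc k))
sumTo-sucˡ zero    f = refl
sumTo-sucˡ (suc n) f = trans (cong (_+ f (suc (suc n))) (sumTo-sucˡ n f)) (ℚP.+-assoc (f 0) _ _)

sumTo-truncate : ∀ {m} n {f : ℕ → ℚ} → m ≤ n → (∀ k → m < k → f k ≡ 0ℚ) → sumTo n f ≡ sumTo m f
sumTo-truncate {m} n {f} m≤n f≡0 with ℕP.m≤n⇒∃[o]m+o≡n m≤n
... | d , refl = extend d
  where
  extend : ∀ d → sumTo (m ℕ.+ d) f ≡ sumTo m f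
  extend zero    = cong (λ k → sumTo k f) (ℕP.+-identityʳ m)
  extend (suc d) = begin
    sumTo (m ℕ.+ suc d) f                       ≡⟨ cong (λ k → sumTo k f) (ℕP.+-suc m d) ⟩
    sumTo (m ℕ.+ d) f + f (suc (m ℕ.+ d))       ≡⟨ cong₂ _+_ (extend d) (f≡0 _ (s≤s (ℕP.m≤m+n m d))) ⟩
    sumTo m f + 0ℚ                              ≡⟨ ℚP.+-identityʳ (sumTo m f) ⟩
    sumTo m f                                   ∎
    where open ≡-Reasoning

sumTo-reverse : ∀ n (f : ℕ → ℚ) → sumTo n f ≡ sumTo n (λ k → f (n ∸ k))
sumTo-reverse zero    f = refl
sumTo-reverse (suc n) f = begin
  sumTo n f + f (suc n)                          ≡⟨ cong (_+ f (suc n)) (sumTo-reverse n f) ⟩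
  sumTo n (λ k → f (n ∸ k)) + f (suc n)          ≡⟨ ℚP.+-comm (sumTo n (λ k → f (n ∸ k))) (f (suc n)) ⟩
  f (suc n) + sumTo n (λ k → f (n ∸ k))          ≡⟨ sumTo-sucˡ n (λ k → f (suc n ∸ k)) ⟨
  sumTo (suc n) (λ k → f (suc n ∸ k))            ∎
  where open ≡-Reasoning

sumTo-shift : ∀ a d {f : ℕ → ℚ} → (∀ k → k < a → f k ≡ 0ℚ) → sumTo (a ℕ.+ d) f ≡ sumTo d (λ t → f (a ℕ.+ t))
sumTo-shift zero    d f≡0 = refl
sumTo-shift (suc a) d {f} f≡0 = begin
  sumTo (suc (a ℕ.+ d)) f                              ≡⟨ sumTo-sucˡ (a ℕ.+ d) f ⟩
  f 0 + sumTo (a ℕ.+ d) (λ k → f (suc k))              ≡⟨ cong (_+ sumTo (a ℕ.+ d) (λ k → f (suc k))) (f≡0 0 (s≤s z≤n)) ⟩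
  0ℚ + sumTo (a ℕ.+ d) (λ k → f (suc k))               ≡⟨ ℚP.+-identityˡ _ ⟩
  sumTo (a ℕ.+ d) (λ k → f (suc k))                    ≡⟨ sumTo-shift a d (λ k k<a → f≡0 (suc k) (s≤s k<a)) ⟩
  sumTo d (λ t → f (suc a ℕ.+ t))                      ∎
  where open ≡-Reasoning

sumTo-antidiagonal : ∀ n (G : ℕ → ℕ → ℚ) → (∀ a b → n < a ℕ.+ b → G a b ≡ 0ℚ) →
  sumTo n (λ a → sumTo n (λ b → G a b)) ≡ sumTo n (λ i → sumTo i (λ a → G a (i ∸ a)))
sumTo-antidiagonal n G G≡0 = begin
  sumTo n (λ a → sumTo n (G a))              ≡⟨ sumTo-cong≤ n row ⟩
  sumTo n (λ a → sumTo n (λ i → H a i))      ≡⟨ sumTo-swap n n H ⟩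
  sumTo n (λ i → sumTo n (λ a → H a i))      ≡⟨ sumTo-cong≤ n column ⟩
  sumTo n (λ i → sumTo i (λ a → G a (i ∸ a))) ∎
  where
  open ≡-Reasoning
  H : ℕ → ℕ → ℚ
  H a i = if does (a ≤? i) then G a (i ∸ a) else 0ℚ
  H-≤ : ∀ {a i} → a ≤ i → H a i ≡ G a (i ∸ a)
  H-≤ {a} {i} a≤i rewrite dec-true (a ≤? i) a≤i = refl
  H-> : ∀ {a i} → i < a → H a i ≡ 0ℚ
  H-> {a} {i} i<a rewrite dec-false (a ≤? i) (ℕP.<⇒≱ i<a) = refl
  row : ∀ a → a ≤ n → sumTo n (G a) ≡ sumTo n (H a)
  row a a≤n = begin
    sumTo n (G a)                          ≡⟨ sumTo-truncate n (ℕP.m∸n≤m n a) G≡0-beyond ⟩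
    sumTo (n ∸ a) (G a)                    ≡⟨ sumTo-cong (n ∸ a) (λ t → sym (trans (H-≤ (ℕP.m≤m+n a t)) (cong (G a) (ℕP.m+n∸m≡n a t)))) ⟩
    sumTo (n ∸ a) (λ t → H a (a ℕ.+ t))    ≡⟨ sumTo-shift a (n ∸ a) (λ k k<a → H-> k<a) ⟨
    sumTo (a ℕ.+ (n ∸ a)) (H a)            ≡⟨ cong (λ m → sumTo m (H a)) (ℕP.m+[n∸m]≡n a≤n) ⟩
    sumTo n (H a)                          ∎
    where
    G≡0-beyond : ∀ k → n ∸ a < k → G a k ≡ 0ℚ
    G≡0-beyond k n∸a<k = G≡0 a k (subst (_< a ℕ.+ k) (ℕP.m+[n∸m]≡n a≤n) (ℕP.+-monoʳ-< a n∸a<k))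
  column : ∀ i → i ≤ n → sumTo n (λ a → H a i) ≡ sumTo i (λ a → G a (i ∸ a))
  column i i≤n = trans (sumTo-truncate n i≤n (λ a i<a → H-> i<a)) (sumTo-cong≤ i (λ a a≤i → H-≤ a≤i))

sumTo-ends : ∀ t (h : ℕ → ℚ) → (∀ k → 0 < k → k ≤ t → h k ≡ 0ℚ) → sumTo (suc t) h ≡ h 0 + h (suc t)
sumTo-ends zero    h _   = refl
sumTo-ends (suc t) h h≡0 = begin
  sumTo (suc t) h + h (suc (suc t))   ≡⟨ cong (_+ h (suc (suc t))) (sumTo-ends t h (λ k 0<k k≤t → h≡0 k 0<k (ℕP.m≤n⇒m≤1+n k≤t))) ⟩
  h 0 + h (suc t) + h (suc (suc t))   ≡⟨ cong (λ q → h 0 + q + h (suc (suc t))) (h≡0 (suc t) (s≤s z≤n) ℕP.≤-refl) ⟩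
  h 0 + 0ℚ + h (suc (suc t))          ≡⟨ cong (_+ h (suc (suc t))) (ℚP.+-identityʳ (h 0)) ⟩
  h 0 + h (suc (suc t))               ∎
  where open ≡-Reasoning

-- Legendre polynomials

legendreTerm : ℕ → ℕ → ℚ → ℚ
legendreTerm k i x = ℕ→ℚ (k C i) * ((- 1ℚ) ^ (k ∸ i)) * ℕ→ℚ ((2 ℕ.* i) C k) * (x ^ ((2 ℕ.* i) ∸ k))

Q : ℕ → ℚ → ℚ
Q k x = sumTo k (λ i → if does (k ≤? (2 ℕ.* i)) then legendreTerm k i x else 0ℚ)

P≡Q/2^k : ∀ k x → P k x ≡ (1 ÷ℕ (2 ℕ.^ k)) * Q k x
P≡Q/2^k k x = refl

Q≡sumTo-legendreTerm : ∀ k x → Q k x ≡ sumTo k (λ i → legendreTerm k i x)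
Q≡sumTo-legendreTerm k x = sumTo-cong k (λ i → guard-redundant i (k ≤? (2 ℕ.* i)))
  where
  guard-redundant : ∀ i (k≤?2i : Dec (k ≤ 2 ℕ.* i)) →
    (if does k≤?2i then legendreTerm k i x else 0ℚ) ≡ legendreTerm k i x
  guard-redundant i (yes _)   = refl
  guard-redundant i (no k≰2i) = sym (trans
    (cong (λ c → ℕ→ℚ (k C i) * ((- 1ℚ) ^ (k ∸ i)) * ℕ→ℚ c * (x ^ ((2 ℕ.* i) ∸ k))) (k>n⇒nCk≡0 (ℕP.≰⇒> k≰2i)))
    (vanish (ℕ→ℚ (k C i)) ((- 1ℚ) ^ (k ∸ i)) (x ^ ((2 ℕ.* i) ∸ k))))
    where
    vanish : ∀ a s p → a * s * 0ℚ * p ≡ 0ℚ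
    vanish = solve-∀ ℚ-ring

legendreTerm-vanishes : ∀ k i x → k < i → legendreTerm k i x ≡ 0ℚ
legendreTerm-vanishes k i x k<i =
  trans (cong (λ c → ℕ→ℚ c * ((- 1ℚ) ^ (k ∸ i)) * ℕ→ℚ ((2 ℕ.* i) C k) * (x ^ ((2 ℕ.* i) ∸ k))) (k>n⇒nCk≡0 k<i))
        (vanish ((- 1ℚ) ^ (k ∸ i)) (ℕ→ℚ ((2 ℕ.* i) C k)) (x ^ ((2 ℕ.* i) ∸ k)))
  where
  vanish : ∀ s c p → 0ℚ * s * c * p ≡ 0ℚ
  vanish = solve-∀ ℚ-ring

bonnet-term : ∀ K i x → i ≤ suc K →
  ℕ→ℚ (2 ℕ.* (2 ℕ.* K ℕ.+ 3)) * (x * legendreTerm (suc K) i x)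
  ≡ ℕ→ℚ (suc (suc K)) * legendreTerm (suc (suc K)) (suc i) x + ℕ→ℚ (4 ℕ.* suc K) * legendreTerm K i x
bonnet-term K i x i≤K+1 = begin
  a * (x * legendreTerm (suc K) i x)    ≡⟨ a-term ⟩
  α * (σ * p)                           ≡⟨ split α γ (σ * p) ⟩
  (α + γ) * (σ * p) + - γ * (σ * p)     ≡⟨ cong₂ _+_ (cong (_* (σ * p)) (sym β≡α+γ)) (sym c-term) ⟩
  β * (σ * p) + c * legendreTerm K i x  ≡⟨ cong (_+ c * legendreTerm K i x) (sym b-term) ⟩
  b * legendreTerm (suc (suc K)) (suc i) x + c * legendreTerm K i x ∎
  where
  open ≡-Reasoning
  a = ℕ→ℚ (2 ℕ.* (2 ℕ.* K ℕ.+ 3))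
  b = ℕ→ℚ (suc (suc K))
  c = ℕ→ℚ (4 ℕ.* suc K)
  X  = suc K C i
  Y₁ = (2 ℕ.* i) C suc K
  A  = suc (suc K) C suc i
  Bᵢ = suc (suc (2 ℕ.* i)) C suc (suc K)
  Cₖ = K C i
  Y₀ = (2 ℕ.* i) C K
  α = a * (ℕ→ℚ X * ℕ→ℚ Y₁)
  β = b * (ℕ→ℚ A * ℕ→ℚ Bᵢ)
  γ = c * (ℕ→ℚ Cₖ * ℕ→ℚ Y₀)
  σ = (- 1ℚ) ^ (suc K ∸ i)
  p = x ^ ((2 ℕ.* i) ∸ K)
  q = x ^ ((2 ℕ.* i) ∸ suc K)

  ℕ→ℚ-monomial : ∀ u v w → ℕ→ℚ (u ℕ.* (v ℕ.* w)) ≡ ℕ→ℚ u * (ℕ→ℚ v * ℕ→ℚ w)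
  ℕ→ℚ-monomial u v w = trans (ℕ→ℚ-homo-* u (v ℕ.* w)) (cong (ℕ→ℚ u *_) (ℕ→ℚ-homo-* v w))

  β≡α+γ : β ≡ α + γ
  β≡α+γ = begin
    β                                                                   ≡⟨ ℕ→ℚ-monomial (suc (suc K)) A Bᵢ ⟨
    ℕ→ℚ (suc (suc K) ℕ.* (A ℕ.* Bᵢ))                                     ≡⟨ cong ℕ→ℚ (bonnet-coefficients K i) ⟨
    ℕ→ℚ (2 ℕ.* (2 ℕ.* K ℕ.+ 3) ℕ.* (X ℕ.* Y₁) ℕ.+ 4 ℕ.* suc K ℕ.* (Cₖ ℕ.* Y₀))
      ≡⟨ ℕ→ℚ-homo-+ (2 ℕ.* (2 ℕ.* K ℕ.+ 3) ℕ.* (X ℕ.* Y₁)) (4 ℕ.* suc K ℕ.* (Cₖ ℕ.* Y₀)) ⟩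
    ℕ→ℚ (2 ℕ.* (2 ℕ.* K ℕ.+ 3) ℕ.* (X ℕ.* Y₁)) + ℕ→ℚ (4 ℕ.* suc K ℕ.* (Cₖ ℕ.* Y₀))
      ≡⟨ cong₂ _+_ (ℕ→ℚ-monomial (2 ℕ.* (2 ℕ.* K ℕ.+ 3)) X Y₁) (ℕ→ℚ-monomial (4 ℕ.* suc K) Cₖ Y₀) ⟩
    α + γ                                                               ∎

  split : ∀ α γ s → α * s ≡ (α + γ) * s + - γ * s
  split = solve-∀ ℚ-ring

  a-term : a * (x * legendreTerm (suc K) i x) ≡ α * (σ * p)
  a-term = trans (regroup a x (ℕ→ℚ X) σ (ℕ→ℚ Y₁) q) power
    where
    regroup : ∀ a x X σ Y q → a * (x * (X * σ * Y * q)) ≡ a * (X * Y) * (σ * (x * q))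
    regroup = solve-∀ ℚ-ring
    power : α * (σ * (x * q)) ≡ α * (σ * p)
    power = power′ (suc K ≤? 2 ℕ.* i)
      where
      power′ : Dec (suc K ≤ 2 ℕ.* i) → α * (σ * (x * q)) ≡ α * (σ * p)
      power′ (yes K<2i) = cong (λ n → α * (σ * x ^ n)) (sym (ℕP.+-∸-assoc 1 K<2i))
      power′ (no  K≮2i) = *-cong-unless-zero α (inj₁ (trans (cong (λ y → a * (ℕ→ℚ X * ℕ→ℚ y)) (k>n⇒nCk≡0 (ℕP.≰⇒> K≮2i)))
                                                (trans (cong (a *_) (ℚP.*-zeroʳ (ℕ→ℚ X))) (ℚP.*-zeroʳ a))))

  b-term : b * legendreTerm (suc (suc K)) (suc i) x ≡ β * (σ * p)
  b-term = trans (cong (λ n → b * (ℕ→ℚ A * σ * ℕ→ℚ (n C suc (suc K)) * x ^ (n ∸ suc (suc K)))) (2[1+i]≡2+2i i))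
                 (regroup b (ℕ→ℚ A) σ (ℕ→ℚ Bᵢ) p)
    where
    2[1+i]≡2+2i : ∀ i → 2 ℕ.* suc i ≡ suc (suc (2 ℕ.* i))
    2[1+i]≡2+2i = ℕ-Solver.solve-∀
    regroup : ∀ b A σ Bᵢ p → b * (A * σ * Bᵢ * p) ≡ b * (A * Bᵢ) * (σ * p)
    regroup = solve-∀ ℚ-ring

  c-term : c * legendreTerm K i x ≡ - γ * (σ * p)
  c-term = c-term′ (i ≤? K)
    where
    flip : ∀ c C s Y p → c * (C * s * Y * p) ≡ - (c * (C * Y)) * ((- 1ℚ * s) * p)
    flip = solve-∀ ℚ-ring
    vanish : ∀ c Y s → - (c * (0ℚ * Y)) * s ≡ 0ℚ
    vanish = solve-∀ ℚ-ring
    c-term′ : Dec (i ≤ K) → c * legendreTerm K i x ≡ - γ * (σ * p)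
    c-term′ (yes i≤K) = trans (flip c (ℕ→ℚ Cₖ) ((- 1ℚ) ^ (K ∸ i)) (ℕ→ℚ Y₀) p)
                            (cong (λ s → - γ * (s * p)) (cong ((- 1ℚ) ^_) (sym (ℕP.+-∸-assoc 1 i≤K))))
    c-term′ (no  i≰K) = trans (cong (c *_) (legendreTerm-vanishes K i x (ℕP.≰⇒> i≰K)))
                    (trans (ℚP.*-zeroʳ c) (sym (trans (cong (λ y → - (c * (ℕ→ℚ y * ℕ→ℚ Y₀)) * (σ * p)) (k>n⇒nCk≡0 (ℕP.≰⇒> i≰K)))
                                                      (vanish c (ℕ→ℚ Y₀) (σ * p)))))

-- For k = 0 the junk value Q (0 ∸ 1) = Q 0 is multiplied by 4 * 0.
Q-bonnet : ∀ k x →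
  ℕ→ℚ (2 ℕ.* (2 ℕ.* k ℕ.+ 1)) * (x * Q k x) ≡ ℕ→ℚ (suc k) * Q (suc k) x + ℕ→ℚ (4 ℕ.* k) * Q (k ∸ 1) x
Q-bonnet zero    x = base x
  where
  base : ∀ x → (1ℚ + 1ℚ) * (x * 1ℚ) ≡ 1ℚ * (0ℚ + 1ℚ * 1ℚ * (1ℚ + 1ℚ) * (x * 1ℚ)) + 0ℚ * 1ℚ
  base = solve-∀ ℚ-ring
Q-bonnet (suc K) x = begin
  ℕ→ℚ (2 ℕ.* (2 ℕ.* suc K ℕ.+ 1)) * (x * Q (suc K) x)
    ≡⟨ cong₂ (λ n q → ℕ→ℚ n * (x * q)) (2[2[1+K]+1]≡2[2K+3] K) (Q≡sumTo-legendreTerm (suc K) x) ⟩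
  a * (x * sumTo (suc K) (λ i → T (suc K) i))
    ≡⟨ cong (a *_) (*-distribˡ-sumTo (suc K) x (T (suc K))) ⟩
  a * sumTo (suc K) (λ i → x * T (suc K) i)
    ≡⟨ *-distribˡ-sumTo (suc K) a (λ i → x * T (suc K) i) ⟩
  sumTo (suc K) (λ i → a * (x * T (suc K) i))
    ≡⟨ sumTo-cong≤ (suc K) (λ i i≤K+1 → bonnet-term K i x i≤K+1) ⟩
  sumTo (suc K) (λ i → b * T (suc (suc K)) (suc i) + c * T K i)
    ≡⟨ sumTo-+ (suc K) (λ i → b * T (suc (suc K)) (suc i)) (λ i → c * T K i) ⟩
  sumTo (suc K) (λ i → b * T (suc (suc K)) (suc i)) + sumTo (suc K) (λ i → c * T K i)
    ≡⟨ cong₂ _+_ (sym (*-distribˡ-sumTo (suc K) b (λ i → T (suc (suc K)) (suc i))))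
                 (sym (*-distribˡ-sumTo (suc K) c (T K))) ⟩
  b * sumTo (suc K) (λ i → T (suc (suc K)) (suc i)) + c * sumTo (suc K) (T K)
    ≡⟨ cong₂ (λ u v → b * u + c * v) (sym Q[K+2]) (sumTo-truncate (suc K) (ℕP.n≤1+n K) (λ i K<i → legendreTerm-vanishes K i x K<i)) ⟩
  b * Q (suc (suc K)) x + c * sumTo K (T K)
    ≡⟨ cong (λ v → b * Q (suc (suc K)) x + c * v) (sym (Q≡sumTo-legendreTerm K x)) ⟩
  b * Q (suc (suc K)) x + c * Q K x ∎
  where
  open ≡-Reasoning
  a = ℕ→ℚ (2 ℕ.* (2 ℕ.* K ℕ.+ 3))
  b = ℕ→ℚ (suc (suc K))
  c = ℕ→ℚ (4 ℕ.* suc K)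
  T : ℕ → ℕ → ℚ
  T k i = legendreTerm k i x
  2[2[1+K]+1]≡2[2K+3] : ∀ K → 2 ℕ.* (2 ℕ.* suc K ℕ.+ 1) ≡ 2 ℕ.* (2 ℕ.* K ℕ.+ 3)
  2[2[1+K]+1]≡2[2K+3] = ℕ-Solver.solve-∀
  Q[K+2] : Q (suc (suc K)) x ≡ sumTo (suc K) (λ i → T (suc (suc K)) (suc i))
  Q[K+2] = begin
    Q (suc (suc K)) x                                      ≡⟨ Q≡sumTo-legendreTerm (suc (suc K)) x ⟩
    sumTo (suc (suc K)) (T (suc (suc K)))                  ≡⟨ sumTo-sucˡ (suc K) (T (suc (suc K))) ⟩
    T (suc (suc K)) 0 + sumTo (suc K) (λ i → T (suc (suc K)) (suc i))
      ≡⟨ cong (_+ sumTo (suc K) (λ i → T (suc (suc K)) (suc i))) (vanish (ℕ→ℚ (suc (suc K) C 0)) ((- 1ℚ) ^ suc (suc K)) 1ℚ) ⟩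
    0ℚ + sumTo (suc K) (λ i → T (suc (suc K)) (suc i))     ≡⟨ ℚP.+-identityˡ _ ⟩
    sumTo (suc K) (λ i → T (suc (suc K)) (suc i))          ∎
    where
    vanish : ∀ c s p → c * s * 0ℚ * p ≡ 0ℚ
    vanish = solve-∀ ℚ-ring

-- Monomials in the Legendre basis

W : ℕ → ℕ → ℚ
W j k = if does (k ≤? j) ∧ does ((j ∸ k) % 2 ℕ.≟ 0)
  then ((j ! ℕ.* ((j ℕ.+ k ℕ.+ 2) / 2) !) ÷ℕ (((j ∸ k) / 2) ! ℕ.* (j ℕ.+ k ℕ.+ 2) !))
  else 0ℚ

evenW-num evenW-den : ℕ → ℕ → ℕ
evenW-num k m = (k ℕ.+ 2 ℕ.* m) ! ℕ.* (k ℕ.+ m ℕ.+ 1) !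
evenW-den k m = m ! ℕ.* (k ℕ.+ 2 ℕ.* m ℕ.+ k ℕ.+ 2) !

evenW : ℕ → ℕ → ℚ
evenW k m = evenW-num k m ÷ℕ evenW-den k m

evenW-den≢0 : ∀ k m → evenW-den k m ≢ 0
evenW-den≢0 k m = *-≢0 (ℕ.≢-nonZero⁻¹ (m !) {{m ℕP.!≢0}}) (ℕ.≢-nonZero⁻¹ _ {{(k ℕ.+ 2 ℕ.* m ℕ.+ k ℕ.+ 2) ℕP.!≢0}})

if-false : ∀ {A : Set} {b} {x y : A} → b ≡ false → (if b then x else y) ≡ y
if-false refl = refl

if-true : ∀ {A : Set} {b} {x y : A} → b ≡ true → (if b then x else y) ≡ x
if-true refl = refl

W-< : ∀ {j k} → j < k → W j k ≡ 0ℚ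
W-< {j} {k} j<k = if-false (cong (_∧ does ((j ∸ k) % 2 ℕ.≟ 0)) (dec-false (k ≤? j) (ℕP.<⇒≱ j<k)))

W-odd : ∀ k m → W (k ℕ.+ suc (2 ℕ.* m)) k ≡ 0ℚ
W-odd k m = if-false (cong₂ _∧_ (dec-true (k ≤? _) (ℕP.m≤m+n k _)) (cong (λ r → does (r ℕ.≟ 0)) odd))
  where
  odd : (k ℕ.+ suc (2 ℕ.* m) ∸ k) % 2 ≡ 1
  odd = trans (cong (_% 2) (trans (ℕP.m+n∸m≡n k _) (1+2m≡1+m*2 m))) ([m+kn]%n≡m%n 1 m 2)
    where
    1+2m≡1+m*2 : ∀ m → suc (2 ℕ.* m) ≡ 1 ℕ.+ m ℕ.* 2
    1+2m≡1+m*2 = ℕ-Solver.solve-∀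

W-even : ∀ k m → W (k ℕ.+ 2 ℕ.* m) k ≡ evenW k m
W-even k m =
  trans (if-true (cong₂ _∧_ (dec-true (k ≤? j) (ℕP.m≤m+n k _)) (cong (λ r → does (r ℕ.≟ 0)) even)))
        (cong₂ (λ a b → (j ! ℕ.* a !) ÷ℕ (b ! ℕ.* (j ℕ.+ k ℕ.+ 2) !)) half-sum half-difference)
  where
  j = k ℕ.+ 2 ℕ.* m
  j∸k≡m*2 : j ∸ k ≡ m ℕ.* 2
  j∸k≡m*2 = trans (ℕP.m+n∸m≡n k _) (ℕP.*-comm 2 m)
  even : (j ∸ k) % 2 ≡ 0
  even = trans (cong (_% 2) j∸k≡m*2) (m*n%n≡0 m 2)
  half-difference : (j ∸ k) / 2 ≡ m
  half-difference = trans (cong (_/ 2) j∸k≡m*2) (m*n/n≡m m 2)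
  half-sum : (j ℕ.+ k ℕ.+ 2) / 2 ≡ k ℕ.+ m ℕ.+ 1
  half-sum = trans (cong (_/ 2) (sum≡ k m)) (m*n/n≡m (k ℕ.+ m ℕ.+ 1) 2)
    where
    sum≡ : ∀ k m → k ℕ.+ 2 ℕ.* m ℕ.+ k ℕ.+ 2 ≡ (k ℕ.+ m ℕ.+ 1) ℕ.* 2
    sum≡ = ℕ-Solver.solve-∀

evenW-rec-diagonal : ∀ j →
  ℕ→ℚ (2 ℕ.* (2 ℕ.* suc j ℕ.+ 1)) * evenW (suc j) 0 ≡ ℕ→ℚ (suc j) * evenW j 0
evenW-rec-diagonal j =
  cross-multiply₂ (2 ℕ.* (2 ℕ.* suc j ℕ.+ 1)) (suc j) (evenW-num (suc j) 0) (evenW-num j 0)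
    (evenW-den≢0 (suc j) 0) (evenW-den≢0 j 0) (begin
  2 ℕ.* (2 ℕ.* suc j ℕ.+ 1) ℕ.* evenW-num (suc j) 0 ℕ.* evenW-den j 0
    ≡⟨ cong₂ (λ a b → 2 ℕ.* (2 ℕ.* suc j ℕ.+ 1) ℕ.* (a ! ℕ.* b !) ℕ.* (1 ℕ.* D !)) (e₁ j) (e₂ j) ⟩
  2 ℕ.* (2 ℕ.* suc j ℕ.+ 1) ℕ.* (suc j ! ℕ.* suc (suc j) !) ℕ.* (1 ℕ.* D !)
    ≡⟨ identity j (j !) (D !) ⟩
  suc j ℕ.* (j ! ℕ.* suc j !) ℕ.* (1 ℕ.* suc (suc D) !)
    ≡⟨ cong₃ (e₃ j) (e₄ j) (e₅ j) ⟨
  suc j ℕ.* evenW-num j 0 ℕ.* evenW-den (suc j) 0 ∎)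
  where
  open ≡-Reasoning
  D = j ℕ.+ 2 ℕ.* 0 ℕ.+ j ℕ.+ 2
  e₁ : ∀ j → suc j ℕ.+ 2 ℕ.* 0 ≡ suc j
  e₁ = ℕ-Solver.solve-∀
  e₂ : ∀ j → suc j ℕ.+ 0 ℕ.+ 1 ≡ suc (suc j)
  e₂ = ℕ-Solver.solve-∀
  e₃ : ∀ j → j ℕ.+ 2 ℕ.* 0 ≡ j
  e₃ = ℕ-Solver.solve-∀
  e₄ : ∀ j → j ℕ.+ 0 ℕ.+ 1 ≡ suc j
  e₄ = ℕ-Solver.solve-∀
  e₅ : ∀ j → suc j ℕ.+ 2 ℕ.* 0 ℕ.+ suc j ℕ.+ 2 ≡ suc (suc (j ℕ.+ 2 ℕ.* 0 ℕ.+ j ℕ.+ 2))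
  e₅ = ℕ-Solver.solve-∀
  cong₃ : ∀ {a a′ b b′ c c′} → a ≡ a′ → b ≡ b′ → c ≡ c′ →
    suc j ℕ.* (a ! ℕ.* b !) ℕ.* (1 ℕ.* c !) ≡ suc j ℕ.* (a′ ! ℕ.* b′ !) ℕ.* (1 ℕ.* c′ !)
  cong₃ refl refl refl = refl
  identity : ∀ j a F → 2 ℕ.* (2 ℕ.* suc j ℕ.+ 1) ℕ.* ((suc j ℕ.* a) ℕ.* (suc (suc j) ℕ.* (suc j ℕ.* a))) ℕ.* (1 ℕ.* F)
    ≡ suc j ℕ.* (a ℕ.* (suc j ℕ.* a)) ℕ.* (1 ℕ.* (suc (suc (j ℕ.+ 2 ℕ.* 0 ℕ.+ j ℕ.+ 2)) ℕ.* (suc (j ℕ.+ 2 ℕ.* 0 ℕ.+ j ℕ.+ 2) ℕ.* F)))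
  identity = ℕ-Solver.solve-∀

evenW-rec-zero : ∀ m →
  ℕ→ℚ (2 ℕ.* (2 ℕ.* 0 ℕ.+ 1)) * evenW 0 (suc m) ≡ ℕ→ℚ (4 ℕ.* suc 0) * evenW 1 m
evenW-rec-zero m =
  cross-multiply₂ (2 ℕ.* (2 ℕ.* 0 ℕ.+ 1)) (4 ℕ.* suc 0) (evenW-num 0 (suc m)) (evenW-num 1 m)
    (evenW-den≢0 0 (suc m)) (evenW-den≢0 1 m) (begin
  2 ℕ.* (2 ℕ.* 0 ℕ.+ 1) ℕ.* evenW-num 0 (suc m) ℕ.* evenW-den 1 m
    ≡⟨ cong₂ (λ a b → 2 ℕ.* (2 ℕ.* 0 ℕ.+ 1) ℕ.* (a ! ℕ.* b !) ℕ.* (m ! ℕ.* D !)) (e₁ m) (e₂ m) ⟩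
  2 ℕ.* (2 ℕ.* 0 ℕ.+ 1) ℕ.* (suc (1 ℕ.+ 2 ℕ.* m) ! ℕ.* suc (suc m) !) ℕ.* (m ! ℕ.* D !)
    ≡⟨ identity m ((1 ℕ.+ 2 ℕ.* m) !) (m !) (D !) ⟩
  4 ℕ.* suc 0 ℕ.* ((1 ℕ.+ 2 ℕ.* m) ! ℕ.* suc (suc m) !) ℕ.* (suc m ! ℕ.* D !)
    ≡⟨ cong₂ (λ a b → 4 ℕ.* suc 0 ℕ.* ((1 ℕ.+ 2 ℕ.* m) ! ℕ.* a !) ℕ.* (suc m ! ℕ.* b !)) (e₃ m) (e₄ m) ⟨
  4 ℕ.* suc 0 ℕ.* evenW-num 1 m ℕ.* evenW-den 0 (suc m) ∎)
  where
  open ≡-Reasoning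
  D = 1 ℕ.+ 2 ℕ.* m ℕ.+ 1 ℕ.+ 2
  e₁ : ∀ m → 0 ℕ.+ 2 ℕ.* suc m ≡ suc (1 ℕ.+ 2 ℕ.* m)
  e₁ = ℕ-Solver.solve-∀
  e₂ : ∀ m → 0 ℕ.+ suc m ℕ.+ 1 ≡ suc (suc m)
  e₂ = ℕ-Solver.solve-∀
  e₃ : ∀ m → 1 ℕ.+ m ℕ.+ 1 ≡ suc (suc m)
  e₃ = ℕ-Solver.solve-∀
  e₄ : ∀ m → 0 ℕ.+ 2 ℕ.* suc m ℕ.+ 0 ℕ.+ 2 ≡ 1 ℕ.+ 2 ℕ.* m ℕ.+ 1 ℕ.+ 2
  e₄ = ℕ-Solver.solve-∀
  identity : ∀ m A M G →
    2 ℕ.* (2 ℕ.* 0 ℕ.+ 1) ℕ.* ((suc (1 ℕ.+ 2 ℕ.* m) ℕ.* A) ℕ.* (suc (suc m) ℕ.* (suc m ℕ.* M))) ℕ.* (M ℕ.* G)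
    ≡ 4 ℕ.* suc 0 ℕ.* (A ℕ.* (suc (suc m) ℕ.* (suc m ℕ.* M))) ℕ.* ((suc m ℕ.* M) ℕ.* G)
  identity = ℕ-Solver.solve-∀

evenW-rec : ∀ k m →
  ℕ→ℚ (2 ℕ.* (2 ℕ.* suc k ℕ.+ 1)) * evenW (suc k) (suc m)
  ≡ ℕ→ℚ (suc k) * evenW k (suc m) + ℕ→ℚ (4 ℕ.* suc (suc k)) * evenW (suc (suc k)) m
evenW-rec k m =
  cross-multiply₃ α β γ (evenW-num (suc k) (suc m)) (evenW-num k (suc m)) (evenW-num (suc (suc k)) m)
    (evenW-den≢0 (suc k) (suc m)) (evenW-den≢0 k (suc m)) (evenW-den≢0 (suc (suc k)) m) (begin
  α ℕ.* evenW-num (suc k) (suc m) ℕ.* (evenW-den k (suc m) ℕ.* evenW-den (suc (suc k)) m)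
    ≡⟨ cong (λ d → α ℕ.* evenW-num (suc k) (suc m) ℕ.* (evenW-den k (suc m) ℕ.* (M ℕ.* d !))) (e₄ k m) ⟩
  α ℕ.* (suc (k ℕ.+ 2 ℕ.* suc m) ℕ.* F₁ ℕ.* (suc (k ℕ.+ suc m ℕ.+ 1) ℕ.* F₂))
    ℕ.* ((suc m ℕ.* M ℕ.* F₄) ℕ.* (M ℕ.* (suc (suc X) ℕ.* (suc X ℕ.* F₄))))
    ≡⟨ identity k m F₁ F₂ M F₄ ⟩
  β ℕ.* (F₁ ℕ.* F₂) ℕ.* ((suc m ℕ.* M ℕ.* (suc (suc X) ℕ.* (suc X ℕ.* F₄))) ℕ.* (M ℕ.* (suc (suc X) ℕ.* (suc X ℕ.* F₄))))
    ℕ.+ γ ℕ.* (F₁ ℕ.* (suc (k ℕ.+ suc m ℕ.+ 1) ℕ.* F₂)) ℕ.* ((suc m ℕ.* M ℕ.* (suc (suc X) ℕ.* (suc X ℕ.* F₄))) ℕ.* (suc m ℕ.* M ℕ.* F₄))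
    ≡⟨ refold (cong (λ d → suc m ℕ.* M ℕ.* (suc d) !) (e₁ k m)) (cong (λ d → M ℕ.* d !) (e₄ k m))
              (cong₂ (λ a b → a ! ℕ.* b !) (e₂ k m) (e₃ k m)) ⟨
  β ℕ.* evenW-num k (suc m) ℕ.* (evenW-den (suc k) (suc m) ℕ.* evenW-den (suc (suc k)) m)
    ℕ.+ γ ℕ.* evenW-num (suc (suc k)) m ℕ.* (evenW-den (suc k) (suc m) ℕ.* evenW-den k (suc m)) ∎)
  where
  open ≡-Reasoning
  α = 2 ℕ.* (2 ℕ.* suc k ℕ.+ 1)
  β = suc k
  γ = 4 ℕ.* suc (suc k)
  X = k ℕ.+ 2 ℕ.* suc m ℕ.+ k ℕ.+ 2
  F₁ = (k ℕ.+ 2 ℕ.* suc m) !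
  F₂ = (k ℕ.+ suc m ℕ.+ 1) !
  M = m !
  F₄ = X !
  e₁ : ∀ k m → k ℕ.+ 2 ℕ.* suc m ℕ.+ suc k ℕ.+ 2 ≡ suc (k ℕ.+ 2 ℕ.* suc m ℕ.+ k ℕ.+ 2)
  e₁ = ℕ-Solver.solve-∀
  e₂ : ∀ k m → suc (suc k) ℕ.+ 2 ℕ.* m ≡ k ℕ.+ 2 ℕ.* suc m
  e₂ = ℕ-Solver.solve-∀
  e₃ : ∀ k m → suc (suc k) ℕ.+ m ℕ.+ 1 ≡ suc (k ℕ.+ suc m ℕ.+ 1)
  e₃ = ℕ-Solver.solve-∀
  e₄ : ∀ k m → suc (suc k) ℕ.+ 2 ℕ.* m ℕ.+ suc (suc k) ℕ.+ 2 ≡ suc (suc (k ℕ.+ 2 ℕ.* suc m ℕ.+ k ℕ.+ 2))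
  e₄ = ℕ-Solver.solve-∀
  refold : ∀ {d₁ d₁′ d₃ d₃′ n₃ n₃′} → d₁ ≡ d₁′ → d₃ ≡ d₃′ → n₃ ≡ n₃′ →
    β ℕ.* (F₁ ℕ.* F₂) ℕ.* (d₁ ℕ.* d₃) ℕ.+ γ ℕ.* n₃ ℕ.* (d₁ ℕ.* (suc m ℕ.* M ℕ.* F₄))
    ≡ β ℕ.* (F₁ ℕ.* F₂) ℕ.* (d₁′ ℕ.* d₃′) ℕ.+ γ ℕ.* n₃′ ℕ.* (d₁′ ℕ.* (suc m ℕ.* M ℕ.* F₄))
  refold refl refl refl = refl
  identity : ∀ k m F₁ F₂ M F₄ →
    2 ℕ.* (2 ℕ.* suc k ℕ.+ 1) ℕ.* (suc (k ℕ.+ 2 ℕ.* suc m) ℕ.* F₁ ℕ.* (suc (k ℕ.+ suc m ℕ.+ 1) ℕ.* F₂))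
      ℕ.* ((suc m ℕ.* M ℕ.* F₄) ℕ.* (M ℕ.* (suc (suc (k ℕ.+ 2 ℕ.* suc m ℕ.+ k ℕ.+ 2)) ℕ.* (suc (k ℕ.+ 2 ℕ.* suc m ℕ.+ k ℕ.+ 2) ℕ.* F₄))))
    ≡ suc k ℕ.* (F₁ ℕ.* F₂)
        ℕ.* ((suc m ℕ.* M ℕ.* (suc (suc (k ℕ.+ 2 ℕ.* suc m ℕ.+ k ℕ.+ 2)) ℕ.* (suc (k ℕ.+ 2 ℕ.* suc m ℕ.+ k ℕ.+ 2) ℕ.* F₄)))
             ℕ.* (M ℕ.* (suc (suc (k ℕ.+ 2 ℕ.* suc m ℕ.+ k ℕ.+ 2)) ℕ.* (suc (k ℕ.+ 2 ℕ.* suc m ℕ.+ k ℕ.+ 2) ℕ.* F₄))))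
      ℕ.+ 4 ℕ.* suc (suc k) ℕ.* (F₁ ℕ.* (suc (k ℕ.+ suc m ℕ.+ 1) ℕ.* F₂))
        ℕ.* ((suc m ℕ.* M ℕ.* (suc (suc (k ℕ.+ 2 ℕ.* suc m ℕ.+ k ℕ.+ 2)) ℕ.* (suc (k ℕ.+ 2 ℕ.* suc m ℕ.+ k ℕ.+ 2) ℕ.* F₄)))
             ℕ.* (suc m ℕ.* M ℕ.* F₄))
  identity = ℕ-Solver.solve-∀

WRecurrence : ℕ → ℕ → Set
WRecurrence j k = ℕ→ℚ (2 ℕ.* (2 ℕ.* k ℕ.+ 1)) * W (suc j) k
                  ≡ ℕ→ℚ k * W j (k ∸ 1) + ℕ→ℚ (4 ℕ.* suc k) * W j (suc k)

all-vanish : ∀ a b c {u v w} → u ≡ 0ℚ → b * v ≡ 0ℚ → w ≡ 0ℚ → a * u ≡ b * v + c * w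
all-vanish a b c refl bv≡0 refl = trans (ℚP.*-zeroʳ a) (sym (trans (cong₂ _+_ bv≡0 (ℚP.*-zeroʳ c)) (ℚP.+-identityˡ 0ℚ)))

W-rec-beyond : ∀ j k → suc j < k → WRecurrence j k
W-rec-beyond j (suc k) (s≤s j<k) =
  all-vanish (ℕ→ℚ (2 ℕ.* (2 ℕ.* suc k ℕ.+ 1))) (ℕ→ℚ (suc k)) (ℕ→ℚ (4 ℕ.* suc (suc k)))
  (W-< (s≤s j<k)) (trans (cong (ℕ→ℚ (suc k) *_) (W-< j<k)) (ℚP.*-zeroʳ (ℕ→ℚ (suc k))))
  (W-< (ℕP.m<n⇒m<1+n (ℕP.m<n⇒m<1+n j<k)))

W-rec-odd : ∀ k m → WRecurrence (k ℕ.+ 2 ℕ.* m) k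
W-rec-odd k m = all-vanish (ℕ→ℚ (2 ℕ.* (2 ℕ.* k ℕ.+ 1))) (ℕ→ℚ k) (ℕ→ℚ (4 ℕ.* suc k))
  (trans (cong (λ j → W j k) (sym (ℕP.+-suc k (2 ℕ.* m)))) (W-odd k m))
  (lower k) (upper m)
  where
  lower : ∀ k → ℕ→ℚ k * W (k ℕ.+ 2 ℕ.* m) (k ∸ 1) ≡ 0ℚ
  lower zero    = ℚP.*-zeroˡ (W (2 ℕ.* m) 0)
  lower (suc k) = trans (cong (λ j → ℕ→ℚ (suc k) * W j k) (sym (ℕP.+-suc k (2 ℕ.* m))))
                        (trans (cong (ℕ→ℚ (suc k) *_) (W-odd k m)) (ℚP.*-zeroʳ (ℕ→ℚ (suc k))))
  upper : ∀ m → W (k ℕ.+ 2 ℕ.* m) (suc k) ≡ 0ℚ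
  upper zero     = W-< (s≤s (ℕP.≤-reflexive (ℕP.+-identityʳ k)))
  upper (suc m′) = trans (cong (λ j → W j (suc k)) (k+2[1+m]≡1+k+[1+2m] k m′)) (W-odd (suc k) m′)
    where
    k+2[1+m]≡1+k+[1+2m] : ∀ k m → k ℕ.+ 2 ℕ.* suc m ≡ suc k ℕ.+ suc (2 ℕ.* m)
    k+2[1+m]≡1+k+[1+2m] = ℕ-Solver.solve-∀

W-diagonal : ∀ j → W j j ≡ evenW j 0
W-diagonal j = trans (cong (λ i → W i j) (sym (ℕP.+-identityʳ j))) (W-even j 0)

W-rec-diagonal : ∀ j → WRecurrence j (suc j)
W-rec-diagonal j = begin
  ℕ→ℚ (2 ℕ.* (2 ℕ.* suc j ℕ.+ 1)) * W (suc j) (suc j)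
    ≡⟨ cong (ℕ→ℚ (2 ℕ.* (2 ℕ.* suc j ℕ.+ 1)) *_) (W-diagonal (suc j)) ⟩
  ℕ→ℚ (2 ℕ.* (2 ℕ.* suc j ℕ.+ 1)) * evenW (suc j) 0
    ≡⟨ evenW-rec-diagonal j ⟩
  ℕ→ℚ (suc j) * evenW j 0
    ≡⟨ ℚP.+-identityʳ _ ⟨
  ℕ→ℚ (suc j) * evenW j 0 + 0ℚ
    ≡⟨ cong₂ _+_ (cong (ℕ→ℚ (suc j) *_) (sym (W-diagonal j)))
                 (sym (trans (cong (c *_) (W-< (ℕP.m<n⇒m<1+n (ℕP.n<1+n j)))) (ℚP.*-zeroʳ c))) ⟩
  ℕ→ℚ (suc j) * W j j + c * W j (suc (suc j)) ∎
  where
  open ≡-Reasoning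
  c = ℕ→ℚ (4 ℕ.* suc (suc j))

W-rec-even : ∀ k m → WRecurrence (k ℕ.+ suc (2 ℕ.* m)) k
W-rec-even k m = begin
  a k * W (suc (k ℕ.+ suc (2 ℕ.* m))) k
    ≡⟨ cong (a k *_) (trans (cong (λ j → W j k) (1+k+[1+2m]≡k+2[1+m] k m)) (W-even k (suc m))) ⟩
  a k * evenW k (suc m)
    ≡⟨ by-k k ⟩
  ℕ→ℚ k * W (k ℕ.+ suc (2 ℕ.* m)) (k ∸ 1) + c * evenW (suc k) m
    ≡⟨ cong (λ w → ℕ→ℚ k * W (k ℕ.+ suc (2 ℕ.* m)) (k ∸ 1) + c * w)
            (sym (trans (cong (λ j → W j (suc k)) (ℕP.+-suc k (2 ℕ.* m))) (W-even (suc k) m))) ⟩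
  ℕ→ℚ k * W (k ℕ.+ suc (2 ℕ.* m)) (k ∸ 1) + c * W (k ℕ.+ suc (2 ℕ.* m)) (suc k) ∎
  where
  open ≡-Reasoning
  a : ℕ → ℚ
  a k = ℕ→ℚ (2 ℕ.* (2 ℕ.* k ℕ.+ 1))
  c = ℕ→ℚ (4 ℕ.* suc k)
  1+k+[1+2m]≡k+2[1+m] : ∀ k m → suc (k ℕ.+ suc (2 ℕ.* m)) ≡ k ℕ.+ 2 ℕ.* suc m
  1+k+[1+2m]≡k+2[1+m] = ℕ-Solver.solve-∀
  by-k : ∀ k → a k * evenW k (suc m)
    ≡ ℕ→ℚ k * W (k ℕ.+ suc (2 ℕ.* m)) (k ∸ 1) + ℕ→ℚ (4 ℕ.* suc k) * evenW (suc k) m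
  by-k zero     = trans (evenW-rec-zero m) (sym (trans (cong (_+ r) (ℚP.*-zeroˡ (W (suc (2 ℕ.* m)) 0))) (ℚP.+-identityˡ r)))
    where r = ℕ→ℚ (4 ℕ.* 1) * evenW 1 m
  by-k (suc k′) = trans (evenW-rec k′ m)
    (cong (λ w → ℕ→ℚ (suc k′) * w + ℕ→ℚ (4 ℕ.* suc (suc k′)) * evenW (suc (suc k′)) m)
          (sym (trans (cong (λ j → W j k′) (1+k+[1+2m]≡k+2[1+m] k′ m)) (W-even k′ (suc m)))))

even-or-odd : ∀ d → ∃ λ m → d ≡ 2 ℕ.* m ⊎ d ≡ suc (2 ℕ.* m)
even-or-odd zero = 0 , inj₁ refl
even-or-odd (suc d) with even-or-odd d
... | m , inj₁ d≡2m   = m , inj₂ (cong suc d≡2m)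
... | m , inj₂ d≡1+2m = suc m , inj₁ (trans (cong suc d≡1+2m) (2+2m≡2[1+m] m))
  where
  2+2m≡2[1+m] : ∀ m → suc (suc (2 ℕ.* m)) ≡ 2 ℕ.* suc m
  2+2m≡2[1+m] = ℕ-Solver.solve-∀

W-rec : ∀ j k → WRecurrence j k
W-rec j k = by-cases (suc j ℕ.<? k)
  where
  k+[1+[1+2m]]≡k+2[1+m] : ∀ k m → suc (k ℕ.+ suc (2 ℕ.* m)) ≡ k ℕ.+ 2 ℕ.* suc m
  k+[1+[1+2m]]≡k+2[1+m] = ℕ-Solver.solve-∀
  by-offset : k ≤ suc j → ∀ m → suc j ∸ k ≡ 2 ℕ.* m ⊎ suc j ∸ k ≡ suc (2 ℕ.* m) → WRecurrence j k
  by-offset k≤j+1 m (inj₂ d≡1+2m) = subst (λ i → WRecurrence i k)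
    (ℕP.suc-injective (trans (sym (ℕP.+-suc k (2 ℕ.* m))) (trans (cong (k ℕ.+_) (sym d≡1+2m)) (ℕP.m+[n∸m]≡n k≤j+1))))
    (W-rec-odd k m)
  by-offset k≤j+1 zero (inj₁ d≡0) = subst (WRecurrence j)
    (trans (sym (ℕP.m+[n∸m]≡n k≤j+1)) (trans (cong (k ℕ.+_) d≡0) (ℕP.+-identityʳ k)))
    (W-rec-diagonal j)
  by-offset k≤j+1 (suc m) (inj₁ d≡2+2m) = subst (λ i → WRecurrence i k)
    (ℕP.suc-injective (trans (k+[1+[1+2m]]≡k+2[1+m] k m) (trans (cong (k ℕ.+_) (sym d≡2+2m)) (ℕP.m+[n∸m]≡n k≤j+1))))
    (W-rec-even k m)
  by-cases : Dec (suc j < k) → WRecurrence j k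
  by-cases (yes j+1<k) = W-rec-beyond j k j+1<k
  by-cases (no  j+1≮k) = let (m , parity) = even-or-odd (suc j ∸ k) in by-offset (ℕP.≮⇒≥ j+1≮k) m parity

legendreSum : ℕ → ℚ → ℚ
legendreSum j x = sumTo j (λ k → ℕ→ℚ (2 ℕ.* k ℕ.+ 1) * W j k * Q k x)

-- half * ℕ→ℚ 2 normalises to 1ℚ.
halve : ∀ t → t ≡ half * (ℕ→ℚ 2 * t)
halve t = sym (trans (sym (ℚP.*-assoc half (ℕ→ℚ 2) t)) (ℚP.*-identityˡ t))

legendreSum-suc : ∀ j x → legendreSum (suc j) x ≡ x * legendreSum j x
legendreSum-suc j x = begin
  legendreSum (suc j) x                                  ≡⟨ sumTo-cong (suc j) lhs-term ⟩
  sumTo (suc j) (λ k → half * (f₁ k + f₂ k))             ≡⟨ *-distribˡ-sumTo (suc j) half (λ k → f₁ k + f₂ k) ⟨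
  half * sumTo (suc j) (λ k → f₁ k + f₂ k)               ≡⟨ cong (half *_) (sumTo-+ (suc j) f₁ f₂) ⟩
  half * (sumTo (suc j) f₁ + sumTo (suc j) f₂)           ≡⟨ cong (λ s → half * (s + sumTo (suc j) f₂)) Σf₁≡Σg₁ ⟩
  half * (sumTo j g₁ + sumTo (suc j) f₂)                 ≡⟨ cong (λ s → half * (sumTo j g₁ + s)) Σf₂≡Σg₂ ⟩
  half * (sumTo j g₁ + sumTo j g₂)                       ≡⟨ cong (half *_) (sumTo-+ j g₁ g₂) ⟨
  half * sumTo j (λ k → g₁ k + g₂ k)                     ≡⟨ *-distribˡ-sumTo j half (λ k → g₁ k + g₂ k) ⟩
  sumTo j (λ k → half * (g₁ k + g₂ k))                   ≡⟨ sumTo-cong j rhs-term ⟨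
  sumTo j (λ k → x * (ℕ→ℚ (2 ℕ.* k ℕ.+ 1) * c k * q k))  ≡⟨ *-distribˡ-sumTo j x (λ k → ℕ→ℚ (2 ℕ.* k ℕ.+ 1) * c k * q k) ⟨
  x * legendreSum j x                                    ∎
  where
  open ≡-Reasoning
  c : ℕ → ℚ
  c = W j
  q : ℕ → ℚ
  q k = Q k x
  f₁ f₂ g₁ g₂ : ℕ → ℚ
  f₁ k = ℕ→ℚ k * c (k ∸ 1) * q k
  f₂ k = ℕ→ℚ (4 ℕ.* suc k) * c (suc k) * q k
  g₁ k = ℕ→ℚ (suc k) * c k * q (suc k)
  g₂ k = ℕ→ℚ (4 ℕ.* k) * c k * q (k ∸ 1)

  2*[2k+1]≡2[2k+1] : ∀ k → ℕ→ℚ 2 * ℕ→ℚ (2 ℕ.* k ℕ.+ 1) ≡ ℕ→ℚ (2 ℕ.* (2 ℕ.* k ℕ.+ 1))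
  2*[2k+1]≡2[2k+1] k = sym (ℕ→ℚ-homo-* 2 (2 ℕ.* k ℕ.+ 1))

  lhs-term : ∀ k → ℕ→ℚ (2 ℕ.* k ℕ.+ 1) * W (suc j) k * q k ≡ half * (f₁ k + f₂ k)
  lhs-term k = trans (halve _) (cong (half *_) (begin
    ℕ→ℚ 2 * (ℕ→ℚ (2 ℕ.* k ℕ.+ 1) * W (suc j) k * q k)
      ≡⟨ regroup (ℕ→ℚ 2) (ℕ→ℚ (2 ℕ.* k ℕ.+ 1)) (W (suc j) k) (q k) ⟩
    ℕ→ℚ 2 * ℕ→ℚ (2 ℕ.* k ℕ.+ 1) * W (suc j) k * q k
      ≡⟨ cong (λ a → a * W (suc j) k * q k) (2*[2k+1]≡2[2k+1] k) ⟩
    ℕ→ℚ (2 ℕ.* (2 ℕ.* k ℕ.+ 1)) * W (suc j) k * q k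
      ≡⟨ cong (_* q k) (W-rec j k) ⟩
    (ℕ→ℚ k * c (k ∸ 1) + ℕ→ℚ (4 ℕ.* suc k) * c (suc k)) * q k
      ≡⟨ ℚP.*-distribʳ-+ (q k) (ℕ→ℚ k * c (k ∸ 1)) (ℕ→ℚ (4 ℕ.* suc k) * c (suc k)) ⟩
    f₁ k + f₂ k ∎))
    where
    regroup : ∀ t a w q → t * (a * w * q) ≡ t * a * w * q
    regroup = solve-∀ ℚ-ring

  rhs-term : ∀ k → x * (ℕ→ℚ (2 ℕ.* k ℕ.+ 1) * c k * q k) ≡ half * (g₁ k + g₂ k)
  rhs-term k = trans (halve _) (cong (half *_) (begin
    ℕ→ℚ 2 * (x * (ℕ→ℚ (2 ℕ.* k ℕ.+ 1) * c k * q k))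
      ≡⟨ regroup (ℕ→ℚ 2) x (ℕ→ℚ (2 ℕ.* k ℕ.+ 1)) (c k) (q k) ⟩
    c k * (ℕ→ℚ 2 * ℕ→ℚ (2 ℕ.* k ℕ.+ 1) * (x * q k))
      ≡⟨ cong (λ a → c k * (a * (x * q k))) (2*[2k+1]≡2[2k+1] k) ⟩
    c k * (ℕ→ℚ (2 ℕ.* (2 ℕ.* k ℕ.+ 1)) * (x * q k))
      ≡⟨ cong (c k *_) (Q-bonnet k x) ⟩
    c k * (ℕ→ℚ (suc k) * q (suc k) + ℕ→ℚ (4 ℕ.* k) * q (k ∸ 1))
      ≡⟨ distribute (c k) (ℕ→ℚ (suc k)) (q (suc k)) (ℕ→ℚ (4 ℕ.* k)) (q (k ∸ 1)) ⟩
    g₁ k + g₂ k ∎))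
    where
    regroup : ∀ t x a w q → t * (x * (a * w * q)) ≡ w * (t * a * (x * q))
    regroup = solve-∀ ℚ-ring
    distribute : ∀ w a q b r → w * (a * q + b * r) ≡ a * w * q + b * w * r
    distribute = solve-∀ ℚ-ring

  zero-coefficient : ∀ a w {y} → y ≡ 0ℚ → a * y * w ≡ 0ℚ
  zero-coefficient a w refl = trans (cong (_* w) (ℚP.*-zeroʳ a)) (ℚP.*-zeroˡ w)

  Σf₁≡Σg₁ : sumTo (suc j) f₁ ≡ sumTo j g₁
  Σf₁≡Σg₁ = begin
    sumTo (suc j) f₁                   ≡⟨ sumTo-sucˡ j f₁ ⟩
    f₁ 0 + sumTo j g₁                  ≡⟨ cong (_+ sumTo j g₁) (trans (cong (_* q 0) (ℚP.*-zeroˡ (c 0))) (ℚP.*-zeroˡ (q 0))) ⟩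
    0ℚ + sumTo j g₁                    ≡⟨ ℚP.+-identityˡ (sumTo j g₁) ⟩
    sumTo j g₁                         ∎

  Σf₂≡Σg₂ : sumTo (suc j) f₂ ≡ sumTo j g₂
  Σf₂≡Σg₂ = begin
    sumTo (suc j) f₂
      ≡⟨ sumTo-truncate (suc j) (ℕP.n≤1+n j) (λ k j<k → zero-coefficient (ℕ→ℚ (4 ℕ.* suc k)) (q k) (W-< (ℕP.m<n⇒m<1+n j<k))) ⟩
    sumTo j f₂                         ≡⟨ ℚP.+-identityˡ (sumTo j f₂) ⟨
    0ℚ + sumTo j f₂                    ≡⟨ cong (_+ sumTo j f₂) (trans (cong (_* q 0) (ℚP.*-zeroˡ (c 0))) (ℚP.*-zeroˡ (q 0))) ⟨
    g₂ 0 + sumTo j f₂                  ≡⟨ sumTo-sucˡ j g₂ ⟨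
    sumTo (suc j) g₂
      ≡⟨ sumTo-truncate (suc j) (ℕP.n≤1+n j) (λ k j<k → zero-coefficient (ℕ→ℚ (4 ℕ.* k)) (q (k ∸ 1)) (W-< j<k)) ⟩
    sumTo j g₂                         ∎

legendreSum≡half*x^j : ∀ j x → legendreSum j x ≡ half * x ^ j
legendreSum≡half*x^j zero    x = refl
legendreSum≡half*x^j (suc j) x = begin
  legendreSum (suc j) x    ≡⟨ legendreSum-suc j x ⟩
  x * legendreSum j x      ≡⟨ cong (x *_) (legendreSum≡half*x^j j x) ⟩
  x * (half * x ^ j)       ≡⟨ commute x half (x ^ j) ⟩
  half * x ^ suc j         ∎
  where
  open ≡-Reasoning
  commute : ∀ x h p → x * (h * p) ≡ h * (x * p)
  commute = solve-∀ ℚ-ring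

-- Euler and Bernoulli numbers

eulerList-stable : ∀ m {k} → k ≤ m → eulerList m k ≡ E k
eulerList-stable m k≤m with ℕP.m≤n⇒m<n∨m≡n k≤m
eulerList-stable m       k≤m | inj₂ refl = refl
eulerList-stable (suc m) {k} _ | inj₁ (s≤s k≤m) with k ≤? m
... | yes _   = eulerList-stable m k≤m
... | no k≰m = ⊥-elim (k≰m k≤m)

E-suc : ∀ m → E (suc m) ≡ - (half * sumTo m (λ i → ℕ→ℚ (suc m C i) * E i))
E-suc m with suc m ≤? m
... | yes m<m = ⊥-elim (ℕP.n≮n m m<m)
... | no  _   = cong (λ s → - (half * s)) (sumTo-cong≤ m (λ i i≤m → cong (ℕ→ℚ (suc m C i) *_) (eulerList-stable m i≤m)))

bernoulliList-stable : ∀ m {k} → k ≤ m → bernoulliList m k ≡ B k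
bernoulliList-stable m k≤m with ℕP.m≤n⇒m<n∨m≡n k≤m
bernoulliList-stable m       k≤m | inj₂ refl = refl
bernoulliList-stable (suc m) {k} _ | inj₁ (s≤s k≤m) with k ≤? m
... | yes _   = bernoulliList-stable m k≤m
... | no k≰m = ⊥-elim (k≰m k≤m)

B-suc : ∀ m → B (suc m) ≡ - ((1 ÷ℕ (suc m ℕ.+ 1)) * sumTo m (λ i → ℕ→ℚ ((suc m ℕ.+ 1) C i) * B i))
B-suc m with suc m ≤? m
... | yes m<m = ⊥-elim (ℕP.n≮n m m<m)
... | no  _   = cong (λ s → - ((1 ÷ℕ (suc m ℕ.+ 1)) * s))
                     (sumTo-cong≤ m (λ i i≤m → cong (ℕ→ℚ ((suc m ℕ.+ 1) C i) *_) (bernoulliList-stable m i≤m)))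

binomial-sum-E : ∀ m → sumTo (suc m) (λ i → ℕ→ℚ (suc m C i) * E i) ≡ - E (suc m)
binomial-sum-E m = begin
  s + ℕ→ℚ (suc m C suc m) * E (suc m)   ≡⟨ cong (λ c → s + ℕ→ℚ c * E (suc m)) (nCn≡1 (suc m)) ⟩
  s + 1ℚ * E (suc m)                    ≡⟨ cong (λ e → s + 1ℚ * e) (E-suc m) ⟩
  s + 1ℚ * - (half * s)                 ≡⟨ halves s ⟩
  - - (half * s)                        ≡⟨ cong -_ (E-suc m) ⟨
  - E (suc m)                           ∎
  where
  open ≡-Reasoning
  s = sumTo m (λ i → ℕ→ℚ (suc m C i) * E i)
  -- half + half normalises to 1ℚ.
  halves : ∀ s → s + 1ℚ * - (half * s) ≡ - - (half * s)
  halves s = trans (cong (_+ 1ℚ * - (half * s)) (sym (ℚP.*-identityˡ s))) (split half s)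
    where
    split : ∀ h s → (h + h) * s + 1ℚ * - (h * s) ≡ - - (h * s)
    split = solve-∀ ℚ-ring

Epoly-at-1 : ∀ m → Epoly (suc m) 1ℚ ≡ - E (suc m)
Epoly-at-1 m = trans (sumTo-cong (suc m) (λ k → trans (cong (ℕ→ℚ (suc m C k) * E k *_) (1^n≡1 (suc m ∸ k))) (ℚP.*-identityʳ _)))
                     (binomial-sum-E m)

δ₁ : ℕ → ℚ
δ₁ 1 = 1ℚ
δ₁ _ = 0ℚ

binomial-sum-B : ∀ l → sumTo l (λ i → ℕ→ℚ (l C i) * B i) ≡ B l + δ₁ l
binomial-sum-B zero = trans (ℚP.*-identityˡ (B 0)) (sym (ℚP.+-identityʳ (B 0)))
binomial-sum-B (suc zero) = swap (B 1)
  where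
  swap : ∀ b → 1ℚ * 1ℚ + 1ℚ * b ≡ b + 1ℚ
  swap = solve-∀ ℚ-ring
binomial-sum-B (suc (suc m)) = begin
  s + ℕ→ℚ (L C suc m) * B (suc m) + ℕ→ℚ (L C L) * B L
    ≡⟨ cong₂ (λ c d → s + ℕ→ℚ c * B (suc m) + ℕ→ℚ d * B L) LC[L-1]≡L (nCn≡1 L) ⟩
  s + ℕ→ℚ L * B (suc m) + 1ℚ * B L
    ≡⟨ cong (λ b → s + ℕ→ℚ L * b + 1ℚ * B L) B[m+1] ⟩
  s + ℕ→ℚ L * - ((1 ÷ℕ L) * s) + 1ℚ * B L
    ≡⟨ cancel s (ℕ→ℚ L) (1 ÷ℕ L) (B L) (trans (ℚP.*-comm (ℕ→ℚ L) (1 ÷ℕ L)) (÷ℕ-*-cancel 1 L (λ ()))) ⟩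
  B L + 0ℚ ∎
  where
  open ≡-Reasoning
  L = suc (suc m)
  s = sumTo m (λ i → ℕ→ℚ (L C i) * B i)
  LC[L-1]≡L : L C suc m ≡ L
  LC[L-1]≡L = trans (nCk≡nC[n∸k] (ℕP.n≤1+n (suc m))) (trans (cong (L C_) (ℕP.m+n∸n≡m 1 (suc m))) (nC1≡n L))
  B[m+1] : B (suc m) ≡ - ((1 ÷ℕ L) * s)
  B[m+1] = trans (B-suc m) (cong₂ (λ a b → - ((1 ÷ℕ a) * b)) (ℕP.+-comm (suc m) 1)
                                  (sumTo-cong m (λ i → cong (λ a → ℕ→ℚ (a C i) * B i) (ℕP.+-comm (suc m) 1))))
  cancel : ∀ s a i b → a * i ≡ 1ℚ → s + a * - (i * s) + 1ℚ * b ≡ b + 0ℚ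
  cancel s a i b a*i≡1 = trans (regroup s a i b) (trans (cong (λ u → s + - (u * s) + b) a*i≡1) (finish s b))
    where
    regroup : ∀ s a i b → s + a * - (i * s) + 1ℚ * b ≡ s + - ((a * i) * s) + b
    regroup = solve-∀ ℚ-ring
    finish : ∀ s b → s + - (1ℚ * s) + b ≡ b + 0ℚ
    finish = solve-∀ ℚ-ring

binomial-sum-B-reversed : ∀ l → sumTo l (λ j → ℕ→ℚ (l C j) * B (l ∸ j)) ≡ B l + δ₁ l
binomial-sum-B-reversed l = begin
  sumTo l (λ j → ℕ→ℚ (l C j) * B (l ∸ j))              ≡⟨ sumTo-reverse l _ ⟩
  sumTo l (λ j → ℕ→ℚ (l C (l ∸ j)) * B (l ∸ (l ∸ j)))  ≡⟨ sumTo-cong≤ l symmetry ⟩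
  sumTo l (λ i → ℕ→ℚ (l C i) * B i)                    ≡⟨ binomial-sum-B l ⟩
  B l + δ₁ l                                           ∎
  where
  open ≡-Reasoning
  symmetry : ∀ j → j ≤ l → ℕ→ℚ (l C (l ∸ j)) * B (l ∸ (l ∸ j)) ≡ ℕ→ℚ (l C j) * B j
  symmetry j j≤l = cong₂ (λ c i → ℕ→ℚ c * B i) (sym (nCk≡nC[n∸k] j≤l)) (ℕP.m∸[m∸n]≡n j≤l)

-- Appell sums

ℕ→ℚ-pascal : ∀ n k → ℕ→ℚ (n C k) + ℕ→ℚ (n C suc k) ≡ ℕ→ℚ (suc n C suc k)
ℕ→ℚ-pascal n k = trans (sym (ℕ→ℚ-homo-+ (n C k) (n C suc k))) (cong ℕ→ℚ (nCk+nC[k+1]≡[n+1]C[k+1] n k))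

vandermonde : ∀ n a b → sumTo n (λ s → ℕ→ℚ (s C a) * ℕ→ℚ ((n ∸ s) C b)) ≡ ℕ→ℚ (suc n C suc (a ℕ.+ b))
vandermonde zero    zero    zero    = refl
vandermonde zero    zero    (suc b) = refl
vandermonde zero    (suc a) b       = ℚP.*-zeroˡ (ℕ→ℚ (0 C b))
vandermonde (suc n) zero    b       = begin
  sumTo (suc n) (λ s → ℕ→ℚ (s C 0) * ℕ→ℚ ((suc n ∸ s) C b))
    ≡⟨ sumTo-sucˡ n (λ s → ℕ→ℚ (s C 0) * ℕ→ℚ ((suc n ∸ s) C b)) ⟩
  1ℚ * ℕ→ℚ (suc n C b) + sumTo n (λ s → ℕ→ℚ (s C 0) * ℕ→ℚ ((n ∸ s) C b))
    ≡⟨ cong₂ _+_ (ℚP.*-identityˡ (ℕ→ℚ (suc n C b))) (vandermonde n 0 b) ⟩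
  ℕ→ℚ (suc n C b) + ℕ→ℚ (suc n C suc b)
    ≡⟨ ℕ→ℚ-pascal (suc n) b ⟩
  ℕ→ℚ (suc (suc n) C suc b) ∎
  where open ≡-Reasoning
vandermonde (suc n) (suc a) b = begin
  sumTo (suc n) (λ s → ℕ→ℚ (s C suc a) * ℕ→ℚ ((suc n ∸ s) C b))
    ≡⟨ sumTo-sucˡ n (λ s → ℕ→ℚ (s C suc a) * ℕ→ℚ ((suc n ∸ s) C b)) ⟩
  0ℚ * ℕ→ℚ (suc n C b) + sumTo n (λ s → ℕ→ℚ (suc s C suc a) * ℕ→ℚ ((n ∸ s) C b))
    ≡⟨ cong₂ _+_ (ℚP.*-zeroˡ (ℕ→ℚ (suc n C b))) (sumTo-cong n pascal-split) ⟩
  0ℚ + sumTo n (λ s → ℕ→ℚ (s C a) * ℕ→ℚ ((n ∸ s) C b) + ℕ→ℚ (s C suc a) * ℕ→ℚ ((n ∸ s) C b))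
    ≡⟨ ℚP.+-identityˡ _ ⟩
  sumTo n (λ s → ℕ→ℚ (s C a) * ℕ→ℚ ((n ∸ s) C b) + ℕ→ℚ (s C suc a) * ℕ→ℚ ((n ∸ s) C b))
    ≡⟨ sumTo-+ n (λ s → ℕ→ℚ (s C a) * ℕ→ℚ ((n ∸ s) C b)) (λ s → ℕ→ℚ (s C suc a) * ℕ→ℚ ((n ∸ s) C b)) ⟩
  sumTo n (λ s → ℕ→ℚ (s C a) * ℕ→ℚ ((n ∸ s) C b)) + sumTo n (λ s → ℕ→ℚ (s C suc a) * ℕ→ℚ ((n ∸ s) C b))
    ≡⟨ cong₂ _+_ (vandermonde n a b) (vandermonde n (suc a) b) ⟩
  ℕ→ℚ (suc n C suc (a ℕ.+ b)) + ℕ→ℚ (suc n C suc (suc a ℕ.+ b))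
    ≡⟨ ℕ→ℚ-pascal (suc n) (suc (a ℕ.+ b)) ⟩
  ℕ→ℚ (suc (suc n) C suc (suc a ℕ.+ b)) ∎
  where
  open ≡-Reasoning
  pascal-split : ∀ s → ℕ→ℚ (suc s C suc a) * ℕ→ℚ ((n ∸ s) C b)
    ≡ ℕ→ℚ (s C a) * ℕ→ℚ ((n ∸ s) C b) + ℕ→ℚ (s C suc a) * ℕ→ℚ ((n ∸ s) C b)
  pascal-split s = trans (cong (_* ℕ→ℚ ((n ∸ s) C b)) (sym (ℕ→ℚ-pascal s a)))
                         (ℚP.*-distribʳ-+ (ℕ→ℚ ((n ∸ s) C b)) (ℕ→ℚ (s C a)) (ℕ→ℚ (s C suc a)))

appell : (ℕ → ℚ) → ℕ → ℚ → ℚ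
appell α n x = sumTo n (λ i → ℕ→ℚ (suc n C suc i) * α i * x ^ (n ∸ i))

eulerConvolution : ℕ → ℚ → ℚ
eulerConvolution n x = sumTo n (λ k → Epoly k x * Epoly (n ∸ k) x)

E⋆E : ℕ → ℚ
E⋆E i = sumTo i (λ a → E a * E (i ∸ a))

eulerConvolution-appell : ∀ n x → eulerConvolution n x ≡ appell E⋆E n x
eulerConvolution-appell n x = begin
  eulerConvolution n x                                        ≡⟨ sumTo-cong≤ n expand ⟩
  sumTo n (λ s → sumTo n (λ a → sumTo n (λ b → F s a b)))     ≡⟨ sumTo-swap n n (λ s a → sumTo n (F s a)) ⟩
  sumTo n (λ a → sumTo n (λ s → sumTo n (λ b → F s a b)))     ≡⟨ sumTo-cong n (λ a → sumTo-swap n n (λ s b → F s a b)) ⟩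
  sumTo n (λ a → sumTo n (λ b → sumTo n (λ s → F s a b)))     ≡⟨ sumTo-cong n (λ a → sumTo-cong n (λ b → sum-over-s a b)) ⟩
  sumTo n (λ a → sumTo n (λ b → G a b))                       ≡⟨ sumTo-antidiagonal n G G-vanishes ⟩
  sumTo n (λ i → sumTo i (λ a → G a (i ∸ a)))                 ≡⟨ sumTo-cong n antidiagonal ⟩
  appell E⋆E n x                                              ∎
  where
  open ≡-Reasoning
  u : ℕ → ℕ → ℚ
  u s a = ℕ→ℚ (s C a) * E a * x ^ (s ∸ a)
  K : ℕ → ℕ → ℚ
  K a b = E a * E b * x ^ (n ∸ (a ℕ.+ b))
  F : ℕ → ℕ → ℕ → ℚ
  F s a b = ℕ→ℚ (s C a) * ℕ→ℚ ((n ∸ s) C b) * K a b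
  G : ℕ → ℕ → ℚ
  G a b = ℕ→ℚ (suc n C suc (a ℕ.+ b)) * K a b

  Epoly-padded : ∀ s → s ≤ n → Epoly s x ≡ sumTo n (u s)
  Epoly-padded s s≤n = sym (sumTo-truncate n s≤n (λ k s<k →
    trans (cong (λ c → ℕ→ℚ c * E k * x ^ (s ∸ k)) (k>n⇒nCk≡0 s<k)) (vanish (E k) (x ^ (s ∸ k)))))
    where
    vanish : ∀ e p → 0ℚ * e * p ≡ 0ℚ
    vanish = solve-∀ ℚ-ring

  zero-or-exponents : ∀ s a b → s ≤ n →
    ℕ→ℚ (s C a) * ℕ→ℚ ((n ∸ s) C b) ≡ 0ℚ ⊎ (s ∸ a) ℕ.+ ((n ∸ s) ∸ b) ≡ n ∸ (a ℕ.+ b)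
  zero-or-exponents s a b s≤n = by-cases (a ≤? s) (b ≤? n ∸ s)
    where
    by-cases : Dec (a ≤ s) → Dec (b ≤ n ∸ s) →
      ℕ→ℚ (s C a) * ℕ→ℚ ((n ∸ s) C b) ≡ 0ℚ ⊎ (s ∸ a) ℕ.+ ((n ∸ s) ∸ b) ≡ n ∸ (a ℕ.+ b)
    by-cases (no a≰s) _ = inj₁ (trans (cong (λ c → ℕ→ℚ c * ℕ→ℚ ((n ∸ s) C b)) (k>n⇒nCk≡0 (ℕP.≰⇒> a≰s)))
                                      (ℚP.*-zeroˡ (ℕ→ℚ ((n ∸ s) C b))))
    by-cases (yes _) (no b≰t) = inj₁ (trans (cong (λ c → ℕ→ℚ (s C a) * ℕ→ℚ c) (k>n⇒nCk≡0 (ℕP.≰⇒> b≰t)))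
                                            (ℚP.*-zeroʳ (ℕ→ℚ (s C a))))
    by-cases (yes a≤s) (yes b≤t) = inj₂ (sym (begin
      n ∸ (a ℕ.+ b)                                         ≡⟨ cong (_∸ (a ℕ.+ b)) n≡ ⟩
      (a ℕ.+ b) ℕ.+ ((s ∸ a) ℕ.+ ((n ∸ s) ∸ b)) ∸ (a ℕ.+ b)  ≡⟨ ℕP.m+n∸m≡n (a ℕ.+ b) _ ⟩
      (s ∸ a) ℕ.+ ((n ∸ s) ∸ b)                             ∎))
      where
      interchange : ∀ a s′ b t′ → (a ℕ.+ s′) ℕ.+ (b ℕ.+ t′) ≡ (a ℕ.+ b) ℕ.+ (s′ ℕ.+ t′)
      interchange = ℕ-Solver.solve-∀
      n≡ : n ≡ (a ℕ.+ b) ℕ.+ ((s ∸ a) ℕ.+ ((n ∸ s) ∸ b))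
      n≡ = trans (sym (ℕP.m+[n∸m]≡n s≤n))
             (trans (cong₂ ℕ._+_ (sym (ℕP.m+[n∸m]≡n a≤s)) (sym (ℕP.m+[n∸m]≡n b≤t)))
                    (interchange a (s ∸ a) b ((n ∸ s) ∸ b)))

  product-term : ∀ s a b → s ≤ n → u s a * u (n ∸ s) b ≡ F s a b
  product-term s a b s≤n = begin
    u s a * u (n ∸ s) b
      ≡⟨ regroup (ℕ→ℚ (s C a)) (E a) (x ^ (s ∸ a)) (ℕ→ℚ ((n ∸ s) C b)) (E b) (x ^ ((n ∸ s) ∸ b)) ⟩
    ℕ→ℚ (s C a) * ℕ→ℚ ((n ∸ s) C b) * (E a * E b * (x ^ (s ∸ a) * x ^ ((n ∸ s) ∸ b)))
      ≡⟨ *-cong-unless-zero (ℕ→ℚ (s C a) * ℕ→ℚ ((n ∸ s) C b)) (map₂ combine (zero-or-exponents s a b s≤n)) ⟩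
    F s a b ∎
    where
    regroup : ∀ c e p d f q → c * e * p * (d * f * q) ≡ c * d * (e * f * (p * q))
    regroup = solve-∀ ℚ-ring
    combine : (s ∸ a) ℕ.+ ((n ∸ s) ∸ b) ≡ n ∸ (a ℕ.+ b) →
              E a * E b * (x ^ (s ∸ a) * x ^ ((n ∸ s) ∸ b)) ≡ K a b
    combine e = cong (E a * E b *_) (trans (sym (^-distribˡ-+-* x (s ∸ a) ((n ∸ s) ∸ b))) (cong (x ^_) e))

  expand : ∀ s → s ≤ n → Epoly s x * Epoly (n ∸ s) x ≡ sumTo n (λ a → sumTo n (λ b → F s a b))
  expand s s≤n = begin
    Epoly s x * Epoly (n ∸ s) x                          ≡⟨ cong₂ _*_ (Epoly-padded s s≤n) (Epoly-padded (n ∸ s) (ℕP.m∸n≤m n s)) ⟩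
    sumTo n (u s) * sumTo n (u (n ∸ s))                  ≡⟨ sumTo-*-sumTo n n (u s) (u (n ∸ s)) ⟩
    sumTo n (λ a → sumTo n (λ b → u s a * u (n ∸ s) b))  ≡⟨ sumTo-cong n (λ a → sumTo-cong n (λ b → product-term s a b s≤n)) ⟩
    sumTo n (λ a → sumTo n (λ b → F s a b))              ∎

  sum-over-s : ∀ a b → sumTo n (λ s → F s a b) ≡ G a b
  sum-over-s a b = trans (sym (*-distribʳ-sumTo n (K a b) (λ s → ℕ→ℚ (s C a) * ℕ→ℚ ((n ∸ s) C b))))
                         (cong (_* K a b) (vandermonde n a b))

  G-vanishes : ∀ a b → n < a ℕ.+ b → G a b ≡ 0ℚ
  G-vanishes a b n<a+b = trans (cong (λ c → ℕ→ℚ c * K a b) (k>n⇒nCk≡0 (s≤s n<a+b))) (ℚP.*-zeroˡ (K a b))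

  antidiagonal : ∀ i → sumTo i (λ a → G a (i ∸ a)) ≡ ℕ→ℚ (suc n C suc i) * E⋆E i * x ^ (n ∸ i)
  antidiagonal i = begin
    sumTo i (λ a → G a (i ∸ a))
      ≡⟨ sumTo-cong≤ i (λ a a≤i → trans (cong (λ j → ℕ→ℚ (suc n C suc j) * (E a * E (i ∸ a) * x ^ (n ∸ j))) (ℕP.m+[n∸m]≡n a≤i))
                                          (regroup (ℕ→ℚ (suc n C suc i)) (E a * E (i ∸ a)) (x ^ (n ∸ i)))) ⟩
    sumTo i (λ a → ℕ→ℚ (suc n C suc i) * (E a * E (i ∸ a)) * x ^ (n ∸ i))
      ≡⟨ *-distribʳ-sumTo i (x ^ (n ∸ i)) (λ a → ℕ→ℚ (suc n C suc i) * (E a * E (i ∸ a))) ⟨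
    sumTo i (λ a → ℕ→ℚ (suc n C suc i) * (E a * E (i ∸ a))) * x ^ (n ∸ i)
      ≡⟨ cong (_* x ^ (n ∸ i)) (*-distribˡ-sumTo i (ℕ→ℚ (suc n C suc i)) (λ a → E a * E (i ∸ a))) ⟨
    ℕ→ℚ (suc n C suc i) * E⋆E i * x ^ (n ∸ i) ∎
    where
    regroup : ∀ c e p → c * (e * p) ≡ c * e * p
    regroup = solve-∀ ℚ-ring

R-term : ℕ → ℕ → ℕ → ℚ
R-term n l j = ℕ→ℚ ((n ℕ.+ 2) C l) * ℕ→ℚ (l C j) * E (n ∸ l ℕ.+ 1) * B (l ∸ j)

R : ℕ → ℚ → ℚ
R n x = - (8 ÷ℕ (n ℕ.+ 2)) * sumTo n (λ l → sumTo l (λ j → R-term n l j * (half * x ^ j)))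

R-constant : ℕ → ℚ
R-constant i = sumTo i (λ t → ℕ→ℚ ((i ℕ.+ 2) C t) * E (i ∸ t ℕ.+ 1) * B t)

R-at-0 : ∀ i → R i 0ℚ ≡ - (8 ÷ℕ (i ℕ.+ 2)) * (half * R-constant i)
R-at-0 i = cong (- (8 ÷ℕ (i ℕ.+ 2)) *_)
  (trans (sumTo-cong i constant-term) (sym (*-distribˡ-sumTo i half (λ t → ℕ→ℚ ((i ℕ.+ 2) C t) * E (i ∸ t ℕ.+ 1) * B t))))
  where
  constant-term : ∀ l → sumTo l (λ j → R-term i l j * (half * 0ℚ ^ j)) ≡ half * (ℕ→ℚ ((i ℕ.+ 2) C l) * E (i ∸ l ℕ.+ 1) * B l)
  constant-term zero = regroup (E (i ℕ.+ 1)) (B 0) half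
    where
    regroup : ∀ e b h → 1ℚ * 1ℚ * e * b * (h * 1ℚ) ≡ h * (1ℚ * e * b)
    regroup = solve-∀ ℚ-ring
  constant-term (suc l) = begin
    sumTo (suc l) (λ j → R-term i (suc l) j * (half * 0ℚ ^ j))
      ≡⟨ sumTo-sucˡ l (λ j → R-term i (suc l) j * (half * 0ℚ ^ j)) ⟩
    R-term i (suc l) 0 * (half * 1ℚ) + sumTo l (λ j → R-term i (suc l) (suc j) * (half * 0ℚ ^ suc j))
      ≡⟨ cong (R-term i (suc l) 0 * (half * 1ℚ) +_) (sumTo-zero l (λ j _ →
           trans (cong (λ z → R-term i (suc l) (suc j) * (half * z)) (0^[1+n]≡0 j)) (vanish (R-term i (suc l) (suc j)) half))) ⟩
    R-term i (suc l) 0 * (half * 1ℚ) + 0ℚ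
      ≡⟨ regroup (ℕ→ℚ ((i ℕ.+ 2) C suc l)) (E (i ∸ suc l ℕ.+ 1)) (B (suc l)) half ⟩
    half * (ℕ→ℚ ((i ℕ.+ 2) C suc l) * E (i ∸ suc l ℕ.+ 1) * B (suc l)) ∎
    where
    open ≡-Reasoning
    vanish : ∀ a h → a * (h * 0ℚ) ≡ 0ℚ
    vanish = solve-∀ ℚ-ring
    regroup : ∀ c e b h → c * 1ℚ * e * b * (h * 1ℚ) + 0ℚ ≡ h * (c * e * b)
    regroup = solve-∀ ℚ-ring

binomial-rescale : ∀ n j → j ≤ n →
  ℕ→ℚ ((n ℕ.+ 2) C j) * (8 ÷ℕ (n ℕ.+ 2)) ≡ ℕ→ℚ (suc n C suc (n ∸ j)) * (8 ÷ℕ ((n ∸ j) ℕ.+ 2))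
binomial-rescale n j j≤n = cross-multiply₂ ((n ℕ.+ 2) C j) (suc n C suc (n ∸ j)) 8 8
  (λ n+2≡0 → ℕP.m+1+n≢0 n n+2≡0) (λ n∸j+2≡0 → ℕP.m+1+n≢0 (n ∸ j) n∸j+2≡0) (begin
  ((n ℕ.+ 2) C j) ℕ.* 8 ℕ.* (n ∸ j ℕ.+ 2)        ≡⟨ commute ((n ℕ.+ 2) C j) (n ∸ j ℕ.+ 2) ⟩
  8 ℕ.* ((n ∸ j ℕ.+ 2) ℕ.* ((n ℕ.+ 2) C j))      ≡⟨ cong (8 ℕ.*_) absorb ⟩
  8 ℕ.* ((n ℕ.+ 2) ℕ.* (suc n C j))              ≡⟨ cong (λ c → 8 ℕ.* ((n ℕ.+ 2) ℕ.* c)) symmetric ⟩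
  8 ℕ.* ((n ℕ.+ 2) ℕ.* (suc n C suc (n ∸ j)))    ≡⟨ commute (suc n C suc (n ∸ j)) (n ℕ.+ 2) ⟨
  (suc n C suc (n ∸ j)) ℕ.* 8 ℕ.* (n ℕ.+ 2)      ∎)
  where
  open ≡-Reasoning
  commute : ∀ c d → c ℕ.* 8 ℕ.* d ≡ 8 ℕ.* (d ℕ.* c)
  commute = ℕ-Solver.solve-∀
  n+2≡2+n : n ℕ.+ 2 ≡ suc (suc n)
  n+2≡2+n = ℕP.+-comm n 2
  absorb : (n ∸ j ℕ.+ 2) ℕ.* ((n ℕ.+ 2) C j) ≡ (n ℕ.+ 2) ℕ.* (suc n C j)
  absorb = begin
    (n ∸ j ℕ.+ 2) ℕ.* ((n ℕ.+ 2) C j)        ≡⟨ cong₂ (λ a b → a ℕ.* (b C j)) (sym (ℕP.+-∸-comm 2 j≤n)) refl ⟩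
    (n ℕ.+ 2 ∸ j) ℕ.* ((n ℕ.+ 2) C j)        ≡⟨ cong (λ m → (m ∸ j) ℕ.* (m C j)) n+2≡2+n ⟩
    (suc (suc n) ∸ j) ℕ.* (suc (suc n) C j)  ≡⟨ [n+1∸k]*[n+1]Ck≡[n+1]*nCk (suc n) j ⟩
    suc (suc n) ℕ.* (suc n C j)              ≡⟨ cong (ℕ._* (suc n C j)) n+2≡2+n ⟨
    (n ℕ.+ 2) ℕ.* (suc n C j)                ∎
  symmetric : suc n C j ≡ suc n C suc (n ∸ j)
  symmetric = trans (nCk≡nC[n∸k] (ℕP.m≤n⇒m≤1+n j≤n)) (cong (suc n C_) (ℕP.+-∸-assoc 1 j≤n))

R-appell : ∀ n x → R n x ≡ appell (λ i → R i 0ℚ) n x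
R-appell n x = begin
  - a * sumTo n (λ l → sumTo l (H l))                    ≡⟨ cong (- a *_) columns ⟩
  - a * sumTo n (λ j → c j * h j * R-constant (n ∸ j))   ≡⟨ *-distribˡ-sumTo n (- a) (λ j → c j * h j * R-constant (n ∸ j)) ⟩
  sumTo n (λ j → - a * (c j * h j * R-constant (n ∸ j))) ≡⟨ sumTo-cong≤ n reversed-term ⟩
  sumTo n (λ j → f (n ∸ j))                              ≡⟨ sumTo-reverse n f ⟨
  appell (λ i → R i 0ℚ) n x                   ∎
  where
  open ≡-Reasoning
  a = 8 ÷ℕ (n ℕ.+ 2)
  H : ℕ → ℕ → ℚ
  H l j = R-term n l j * (half * x ^ j)
  c : ℕ → ℚ
  c j = ℕ→ℚ ((n ℕ.+ 2) C j)
  h : ℕ → ℚ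
  h j = half * x ^ j
  f : ℕ → ℚ
  f i = ℕ→ℚ (suc n C suc i) * R i 0ℚ * x ^ (n ∸ i)
  R-constant-term : ℕ → ℕ → ℚ
  R-constant-term i t = ℕ→ℚ ((i ℕ.+ 2) C t) * E (i ∸ t ℕ.+ 1) * B t

  H-vanishes : ∀ l j → l < j → H l j ≡ 0ℚ
  H-vanishes l j l<j = trans (cong (λ z → c l * ℕ→ℚ z * E (n ∸ l ℕ.+ 1) * B (l ∸ j) * h j) (k>n⇒nCk≡0 l<j))
                             (vanish (c l) (E (n ∸ l ℕ.+ 1)) (B (l ∸ j)) (h j))
    where
    vanish : ∀ a e b p → a * 0ℚ * e * b * p ≡ 0ℚ
    vanish = solve-∀ ℚ-ring

  H-shift : ∀ j t → j ≤ n → H (j ℕ.+ t) j ≡ c j * R-constant-term (n ∸ j) t * h j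
  H-shift j t j≤n = cong (_* h j) (begin
    ℕ→ℚ ((n ℕ.+ 2) C (j ℕ.+ t)) * ℕ→ℚ ((j ℕ.+ t) C j) * E (n ∸ (j ℕ.+ t) ℕ.+ 1) * B ((j ℕ.+ t) ∸ j)
      ≡⟨ regroup (ℕ→ℚ ((n ℕ.+ 2) C (j ℕ.+ t))) (ℕ→ℚ ((j ℕ.+ t) C j)) (E (n ∸ (j ℕ.+ t) ℕ.+ 1)) (B ((j ℕ.+ t) ∸ j)) ⟩
    ℕ→ℚ ((n ℕ.+ 2) C (j ℕ.+ t)) * ℕ→ℚ ((j ℕ.+ t) C j) * (E (n ∸ (j ℕ.+ t) ℕ.+ 1) * B ((j ℕ.+ t) ∸ j))
      ≡⟨ cong₂ _*_ binomials (cong₂ (λ p q → E (p ℕ.+ 1) * B q) (sym (ℕP.∸-+-assoc n j t)) (ℕP.m+n∸m≡n j t)) ⟩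
    c j * ℕ→ℚ (((n ∸ j) ℕ.+ 2) C t) * (E ((n ∸ j) ∸ t ℕ.+ 1) * B t)
      ≡⟨ regroup′ (c j) (ℕ→ℚ (((n ∸ j) ℕ.+ 2) C t)) (E ((n ∸ j) ∸ t ℕ.+ 1)) (B t) ⟩
    c j * R-constant-term (n ∸ j) t ∎)
    where
    regroup : ∀ a b e d → a * b * e * d ≡ a * b * (e * d)
    regroup = solve-∀ ℚ-ring
    regroup′ : ∀ a b e d → a * b * (e * d) ≡ a * (b * e * d)
    regroup′ = solve-∀ ℚ-ring
    binomials : ℕ→ℚ ((n ℕ.+ 2) C (j ℕ.+ t)) * ℕ→ℚ ((j ℕ.+ t) C j) ≡ c j * ℕ→ℚ (((n ∸ j) ℕ.+ 2) C t)
    binomials = begin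
      ℕ→ℚ ((n ℕ.+ 2) C (j ℕ.+ t)) * ℕ→ℚ ((j ℕ.+ t) C j)        ≡⟨ ℕ→ℚ-homo-* ((n ℕ.+ 2) C (j ℕ.+ t)) ((j ℕ.+ t) C j) ⟨
      ℕ→ℚ (((n ℕ.+ 2) C (j ℕ.+ t)) ℕ.* ((j ℕ.+ t) C j))       ≡⟨ cong ℕ→ℚ (nCl*lCj≡nCj*[n∸j]C[l∸j] (n ℕ.+ 2) (j ℕ.+ t) j (ℕP.m≤m+n j t)) ⟩
      ℕ→ℚ (((n ℕ.+ 2) C j) ℕ.* (((n ℕ.+ 2) ∸ j) C ((j ℕ.+ t) ∸ j)))
        ≡⟨ cong₂ (λ p q → ℕ→ℚ (((n ℕ.+ 2) C j) ℕ.* (p C q))) (ℕP.+-∸-comm 2 j≤n) (ℕP.m+n∸m≡n j t) ⟩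
      ℕ→ℚ (((n ℕ.+ 2) C j) ℕ.* (((n ∸ j) ℕ.+ 2) C t))         ≡⟨ ℕ→ℚ-homo-* ((n ℕ.+ 2) C j) (((n ∸ j) ℕ.+ 2) C t) ⟩
      c j * ℕ→ℚ (((n ∸ j) ℕ.+ 2) C t)                          ∎

  column : ∀ j → j ≤ n → sumTo n (λ l → H l j) ≡ c j * h j * R-constant (n ∸ j)
  column j j≤n = begin
    sumTo n (λ l → H l j)                                    ≡⟨ cong (λ m → sumTo m (λ l → H l j)) (ℕP.m+[n∸m]≡n j≤n) ⟨
    sumTo (j ℕ.+ (n ∸ j)) (λ l → H l j)                      ≡⟨ sumTo-shift j (n ∸ j) (λ l l<j → H-vanishes l j l<j) ⟩
    sumTo (n ∸ j) (λ t → H (j ℕ.+ t) j)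
      ≡⟨ sumTo-cong (n ∸ j) (λ t → trans (H-shift j t j≤n) (swap (c j) (R-constant-term (n ∸ j) t) (h j))) ⟩
    sumTo (n ∸ j) (λ t → c j * h j * R-constant-term (n ∸ j) t) ≡⟨ *-distribˡ-sumTo (n ∸ j) (c j * h j) (R-constant-term (n ∸ j)) ⟨
    c j * h j * R-constant (n ∸ j)                           ∎
    where
    swap : ∀ a b d → a * b * d ≡ a * d * b
    swap = solve-∀ ℚ-ring

  columns : sumTo n (λ l → sumTo l (H l)) ≡ sumTo n (λ j → c j * h j * R-constant (n ∸ j))
  columns = begin
    sumTo n (λ l → sumTo l (H l))          ≡⟨ sumTo-cong≤ n (λ l l≤n → sym (sumTo-truncate n l≤n (H-vanishes l))) ⟩
    sumTo n (λ l → sumTo n (H l))          ≡⟨ sumTo-swap n n H ⟩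
    sumTo n (λ j → sumTo n (λ l → H l j))  ≡⟨ sumTo-cong≤ n column ⟩
    sumTo n (λ j → c j * h j * R-constant (n ∸ j)) ∎

  reversed-term : ∀ j → j ≤ n → - a * (c j * h j * R-constant (n ∸ j)) ≡ f (n ∸ j)
  reversed-term j j≤n = begin
    - a * (c j * h j * R-constant (n ∸ j))
      ≡⟨ regroup a (c j) half (x ^ j) (R-constant (n ∸ j)) ⟩
    - (c j * a) * (half * x ^ j * R-constant (n ∸ j))
      ≡⟨ cong (λ z → - z * (half * x ^ j * R-constant (n ∸ j))) (binomial-rescale n j j≤n) ⟩
    - (ℕ→ℚ (suc n C suc (n ∸ j)) * a′) * (half * x ^ j * R-constant (n ∸ j))
      ≡⟨ regroup′ a′ (ℕ→ℚ (suc n C suc (n ∸ j))) half (x ^ j) (R-constant (n ∸ j)) ⟩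
    ℕ→ℚ (suc n C suc (n ∸ j)) * (- a′ * (half * R-constant (n ∸ j))) * x ^ j
      ≡⟨ cong₂ (λ p q → ℕ→ℚ (suc n C suc (n ∸ j)) * p * x ^ q) (sym (R-at-0 (n ∸ j))) (sym (ℕP.m∸[m∸n]≡n j≤n)) ⟩
    f (n ∸ j) ∎
    where
    a′ = 8 ÷ℕ ((n ∸ j) ℕ.+ 2)
    regroup : ∀ a c h p β → - a * (c * (h * p) * β) ≡ - (c * a) * (h * p * β)
    regroup = solve-∀ ℚ-ring
    regroup′ : ∀ b d h p β → - (d * b) * (h * p * β) ≡ d * (- b * (h * β)) * p
    regroup′ = solve-∀ ℚ-ring

appell-at-1 : ∀ α t → appell α (suc t) 1ℚ ≡ sumTo t (λ i → ℕ→ℚ (suc (suc t) C suc i) * α i) + α (suc t)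
appell-at-1 α t = cong₂ _+_
  (sumTo-cong t (λ i → trans (cong (ℕ→ℚ (suc (suc t) C suc i) * α i *_) (1^n≡1 (suc t ∸ i))) (ℚP.*-identityʳ _)))
  (begin
    ℕ→ℚ (suc (suc t) C suc (suc t)) * α (suc t) * 1ℚ ^ (t ∸ t)   ≡⟨ cong (ℕ→ℚ (suc (suc t) C suc (suc t)) * α (suc t) *_) (1^n≡1 (t ∸ t)) ⟩
    ℕ→ℚ (suc (suc t) C suc (suc t)) * α (suc t) * 1ℚ           ≡⟨ ℚP.*-identityʳ _ ⟩
    ℕ→ℚ (suc (suc t) C suc (suc t)) * α (suc t)                ≡⟨ cong (λ c → ℕ→ℚ c * α (suc t)) (nCn≡1 (suc (suc t))) ⟩
    1ℚ * α (suc t)                                             ≡⟨ ℚP.*-identityˡ (α (suc t)) ⟩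
    α (suc t)                                                  ∎)
  where open ≡-Reasoning

appell-unique : ∀ (α β d : ℕ → ℚ) →
  (∀ t → appell α (suc t) 1ℚ ≡ α (suc t) + d t) →
  (∀ t → appell β (suc t) 1ℚ ≡ β (suc t) + d t) →
  ∀ i → α i ≡ β i
appell-unique α β d α-increment β-increment i = agree i i ℕP.≤-refl
  where
  weighted : (ℕ → ℚ) → ℕ → ℚ
  weighted γ t = sumTo t (λ i → ℕ→ℚ (suc (suc t) C suc i) * γ i)

  weighted≡d : ∀ γ → (∀ t → appell γ (suc t) 1ℚ ≡ γ (suc t) + d t) → ∀ t → weighted γ t ≡ d t
  weighted≡d γ γ-increment t = +-cancelˡ (γ (suc t)) (weighted γ t) (d t) (begin
    γ (suc t) + weighted γ t       ≡⟨ ℚP.+-comm (γ (suc t)) (weighted γ t) ⟩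
    weighted γ t + γ (suc t)       ≡⟨ appell-at-1 γ t ⟨
    appell γ (suc t) 1ℚ            ≡⟨ γ-increment t ⟩
    γ (suc t) + d t                ∎)
    where open ≡-Reasoning

  weighted-α≡weighted-β : ∀ t → weighted α t ≡ weighted β t
  weighted-α≡weighted-β t = trans (weighted≡d α α-increment t) (sym (weighted≡d β β-increment t))

  *-cancelˡ-suc : ∀ k {a b} → ℕ→ℚ (suc k) * a ≡ ℕ→ℚ (suc k) * b → a ≡ b
  *-cancelˡ-suc k {a} {b} eq = *-cancelʳ-ℕ→ℚ (suc k) (λ ()) (trans (ℚP.*-comm a _) (trans eq (ℚP.*-comm _ b)))

  next : ∀ t → (∀ i → i ≤ t → α i ≡ β i) → α (suc t) ≡ β (suc t)
  next t below = *-cancelˡ-suc (suc (suc t)) (+-cancelˡ (lower β) (ℕ→ℚ top * α (suc t)) (ℕ→ℚ top * β (suc t)) (begin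
    lower β + ℕ→ℚ top * α (suc t)                 ≡⟨ cong₂ (λ s c → s + ℕ→ℚ c * α (suc t)) lower-agree (sym [n+1]Cn≡n+1) ⟩
    lower α + ℕ→ℚ (top C suc (suc t)) * α (suc t) ≡⟨ weighted-α≡weighted-β (suc t) ⟩
    lower β + ℕ→ℚ (top C suc (suc t)) * β (suc t) ≡⟨ cong (λ c → lower β + ℕ→ℚ c * β (suc t)) [n+1]Cn≡n+1 ⟩
    lower β + ℕ→ℚ top * β (suc t)                 ∎))
    where
    open ≡-Reasoning
    top = suc (suc (suc t))
    lower : (ℕ → ℚ) → ℚ
    lower γ = sumTo t (λ i → ℕ→ℚ (top C suc i) * γ i)
    lower-agree : lower β ≡ lower α
    lower-agree = sumTo-cong≤ t (λ i i≤t → cong (ℕ→ℚ (top C suc i) *_) (sym (below i i≤t)))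
    [n+1]Cn≡n+1 : top C suc (suc t) ≡ top
    [n+1]Cn≡n+1 = trans (nCk≡nC[n∸k] (ℕP.n≤1+n (suc (suc t)))) (trans (cong (top C_) (ℕP.m+n∸n≡m 1 (suc (suc t)))) (nC1≡n top))

  agree : ∀ t i → i ≤ t → α i ≡ β i
  agree zero    zero _     = *-cancelˡ-suc 1 (weighted-α≡weighted-β 0)
  agree (suc t) i  i≤1+t = [ (λ { (s≤s i≤t) → agree t i i≤t }) , (λ { refl → next t (agree t) }) ]′ (ℕP.m≤n⇒m<n∨m≡n i≤1+t)

eulerConvolution-at-1 : ∀ t → eulerConvolution (suc t) 1ℚ ≡ E⋆E (suc t) + - (ℕ→ℚ 4 * E (suc t))
eulerConvolution-at-1 t = begin
  sumTo n f                       ≡⟨ sumTo-cong n (λ k → split (f k) (g k)) ⟩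
  sumTo n (λ k → g k + h k)       ≡⟨ sumTo-+ n g h ⟩
  E⋆E n + sumTo n h               ≡⟨ cong (E⋆E n +_) (sumTo-ends t h interior) ⟩
  E⋆E n + (h 0 + h n)             ≡⟨ cong (E⋆E n +_) ends ⟩
  E⋆E n + - (ℕ→ℚ 4 * E n)         ∎
  where
  open ≡-Reasoning
  n = suc t
  f g h : ℕ → ℚ
  f k = Epoly k 1ℚ * Epoly (n ∸ k) 1ℚ
  g k = E k * E (n ∸ k)
  h k = f k + - g k
  split : ∀ a b → a ≡ b + (a + - b)
  split = solve-∀ ℚ-ring
  interior : ∀ k → 0 < k → k ≤ t → h k ≡ 0ℚ
  interior (suc k) _ k<n = begin
    Epoly (suc k) 1ℚ * Epoly (n ∸ suc k) 1ℚ + - g (suc k)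
      ≡⟨ cong (λ m → Epoly (suc k) 1ℚ * Epoly m 1ℚ + - g (suc k)) n∸[1+k]≡1+[t∸[1+k]] ⟩
    Epoly (suc k) 1ℚ * Epoly (suc (t ∸ suc k)) 1ℚ + - g (suc k)
      ≡⟨ cong₂ (λ p q → p * q + - g (suc k)) (Epoly-at-1 k) (Epoly-at-1 (t ∸ suc k)) ⟩
    - E (suc k) * - E (suc (t ∸ suc k)) + - (E (suc k) * E (n ∸ suc k))
      ≡⟨ cong (λ m → - E (suc k) * - E m + - (E (suc k) * E (n ∸ suc k))) n∸[1+k]≡1+[t∸[1+k]] ⟨
    - E (suc k) * - E (n ∸ suc k) + - (E (suc k) * E (n ∸ suc k))
      ≡⟨ signs (E (suc k)) (E (n ∸ suc k)) ⟩
    0ℚ ∎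
    where
    n∸[1+k]≡1+[t∸[1+k]] : n ∸ suc k ≡ suc (t ∸ suc k)
    n∸[1+k]≡1+[t∸[1+k]] = ℕP.+-∸-assoc 1 k<n
    signs : ∀ a b → - a * - b + - (a * b) ≡ 0ℚ
    signs = solve-∀ ℚ-ring
  ends : h 0 + h n ≡ - (ℕ→ℚ 4 * E n)
  ends = begin
    (1ℚ * Epoly n 1ℚ + - (1ℚ * E n)) + (Epoly n 1ℚ * Epoly (n ∸ n) 1ℚ + - (E n * E (n ∸ n)))
      ≡⟨ cong₂ (λ p m → (1ℚ * p + - (1ℚ * E n)) + (p * Epoly m 1ℚ + - (E n * E m))) (Epoly-at-1 t) (ℕP.n∸n≡0 n) ⟩
    (1ℚ * - E n + - (1ℚ * E n)) + (- E n * 1ℚ + - (E n * 1ℚ))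
      ≡⟨ four (E n) ⟩
    - ((1ℚ + 1ℚ + 1ℚ + 1ℚ) * E n) ∎
    where
    four : ∀ e → (1ℚ * - e + - (1ℚ * e)) + (- e * 1ℚ + - (e * 1ℚ)) ≡ - ((1ℚ + 1ℚ + 1ℚ + 1ℚ) * e)
    four = solve-∀ ℚ-ring

R-at-1 : ∀ t → R (suc t) 1ℚ ≡ R (suc t) 0ℚ + - (ℕ→ℚ 4 * E (suc t))
R-at-1 t = begin
  - a * sumTo n (λ l → sumTo l (λ j → R-term n l j * (half * 1ℚ ^ j)))
    ≡⟨ cong (- a *_) (sumTo-cong n row-at-1) ⟩
  - a * sumTo n (λ l → half * constantTerm l + half * (c l * δ₁ l))
    ≡⟨ cong (- a *_) (sumTo-+ n (λ l → half * constantTerm l) (λ l → half * (c l * δ₁ l))) ⟩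
  - a * (sumTo n (λ l → half * constantTerm l) + sumTo n (λ l → half * (c l * δ₁ l)))
    ≡⟨ cong₂ (λ p q → - a * (p + q)) (sym (*-distribˡ-sumTo n half constantTerm)) δ-sum ⟩
  - a * (half * R-constant n + half * (c 1 * 1ℚ))
    ≡⟨ ℚP.*-distribˡ-+ (- a) (half * R-constant n) (half * (c 1 * 1ℚ)) ⟩
  - a * (half * R-constant n) + - a * (half * (c 1 * 1ℚ))
    ≡⟨ cong₂ _+_ (sym (R-at-0 n)) δ-term ⟩
  R n 0ℚ + - (ℕ→ℚ 4 * E n) ∎
  where
  open ≡-Reasoning
  n = suc t
  a = 8 ÷ℕ (n ℕ.+ 2)
  c : ℕ → ℚ
  c l = ℕ→ℚ ((n ℕ.+ 2) C l) * E (n ∸ l ℕ.+ 1)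
  constantTerm : ℕ → ℚ
  constantTerm l = ℕ→ℚ ((n ℕ.+ 2) C l) * E (n ∸ l ℕ.+ 1) * B l

  row-at-1 : ∀ l → sumTo l (λ j → R-term n l j * (half * 1ℚ ^ j)) ≡ half * constantTerm l + half * (c l * δ₁ l)
  row-at-1 l = begin
    sumTo l (λ j → R-term n l j * (half * 1ℚ ^ j))
      ≡⟨ sumTo-cong l (λ j → trans (cong (λ z → R-term n l j * (half * z)) (1^n≡1 j))
                                   (regroup (ℕ→ℚ ((n ℕ.+ 2) C l)) (ℕ→ℚ (l C j)) (E (n ∸ l ℕ.+ 1)) (B (l ∸ j)) half)) ⟩
    sumTo l (λ j → half * c l * (ℕ→ℚ (l C j) * B (l ∸ j)))
      ≡⟨ *-distribˡ-sumTo l (half * c l) (λ j → ℕ→ℚ (l C j) * B (l ∸ j)) ⟨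
    half * c l * sumTo l (λ j → ℕ→ℚ (l C j) * B (l ∸ j))
      ≡⟨ cong (half * c l *_) (binomial-sum-B-reversed l) ⟩
    half * c l * (B l + δ₁ l)
      ≡⟨ distribute half (c l) (B l) (δ₁ l) ⟩
    half * constantTerm l + half * (c l * δ₁ l) ∎
    where
    regroup : ∀ a b e d h → a * b * e * d * (h * 1ℚ) ≡ h * (a * e) * (b * d)
    regroup = solve-∀ ℚ-ring
    distribute : ∀ h c b d → h * c * (b + d) ≡ h * (c * b) + h * (c * d)
    distribute = solve-∀ ℚ-ring

  δ-sum : sumTo n (λ l → half * (c l * δ₁ l)) ≡ half * (c 1 * 1ℚ)
  δ-sum = begin
    sumTo n (λ l → half * (c l * δ₁ l))                      ≡⟨ sumTo-sucˡ t (λ l → half * (c l * δ₁ l)) ⟩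
    half * (c 0 * 0ℚ) + sumTo t (λ l → half * (c (suc l) * δ₁ (suc l)))
      ≡⟨ cong₂ _+_ (vanish half (c 0)) (sumTo-truncate t z≤n (λ { zero () ; (suc l) _ → vanish half (c (suc (suc l))) })) ⟩
    0ℚ + half * (c 1 * 1ℚ)                                   ≡⟨ ℚP.+-identityˡ _ ⟩
    half * (c 1 * 1ℚ)                                        ∎
    where
    vanish : ∀ h c → h * (c * 0ℚ) ≡ 0ℚ
    vanish = solve-∀ ℚ-ring

  δ-term : - a * (half * (c 1 * 1ℚ)) ≡ - (ℕ→ℚ 4 * E n)
  δ-term = begin
    - a * (half * (ℕ→ℚ ((n ℕ.+ 2) C 1) * E (n ∸ 1 ℕ.+ 1) * 1ℚ))
      ≡⟨ cong₂ (λ p q → - a * (half * (ℕ→ℚ p * E q * 1ℚ))) (nC1≡n (n ℕ.+ 2)) (ℕP.+-comm t 1) ⟩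
    - a * (half * (ℕ→ℚ (n ℕ.+ 2) * E n * 1ℚ))
      ≡⟨ regroup a half (ℕ→ℚ (n ℕ.+ 2)) (E n) ⟩
    - (half * (a * ℕ→ℚ (n ℕ.+ 2)) * E n)
      ≡⟨ cong (λ z → - (half * z * E n)) (÷ℕ-*-cancel 8 (n ℕ.+ 2) (λ n+2≡0 → ℕP.m+1+n≢0 n n+2≡0)) ⟩
    - (half * ℕ→ℚ 8 * E n)
      ≡⟨⟩
    - (ℕ→ℚ 4 * E n) ∎
    where
    regroup : ∀ a h N e → - a * (h * (N * e * 1ℚ)) ≡ - (h * (a * N) * e)
    regroup = solve-∀ ℚ-ring

appell-cong : ∀ {α β} n x → (∀ i → α i ≡ β i) → appell α n x ≡ appell β n x
appell-cong n x α≡β = sumTo-cong n (λ i → cong (λ a → ℕ→ℚ (suc n C suc i) * a * x ^ (n ∸ i)) (α≡β i))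

eulerConvolution≡R : ∀ n x → eulerConvolution n x ≡ R n x
eulerConvolution≡R n x = begin
  eulerConvolution n x                   ≡⟨ eulerConvolution-appell n x ⟩
  appell E⋆E n x                         ≡⟨ appell-cong n x (appell-unique E⋆E β d E⋆E-increment β-increment) ⟩
  appell β n x                           ≡⟨ R-appell n x ⟨
  R n x                                  ∎
  where
  open ≡-Reasoning
  β d : ℕ → ℚ
  β i = R i 0ℚ
  d t = - (ℕ→ℚ 4 * E (suc t))
  E⋆E-increment : ∀ t → appell E⋆E (suc t) 1ℚ ≡ E⋆E (suc t) + d t
  E⋆E-increment t = trans (sym (eulerConvolution-appell (suc t) 1ℚ)) (eulerConvolution-at-1 t)
  β-increment : ∀ t → appell β (suc t) 1ℚ ≡ β (suc t) + d t
  β-increment t = trans (sym (R-appell (suc t) 1ℚ)) (R-at-1 t)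

legendreWeight*P≡[2k+1]*Q : ∀ k x → ℕ→ℚ (2 ℕ.^ (k ℕ.+ 1) ℕ.* k ℕ.+ 2 ℕ.^ k) * P k x ≡ ℕ→ℚ (2 ℕ.* k ℕ.+ 1) * Q k x
legendreWeight*P≡[2k+1]*Q k x = begin
  ℕ→ℚ (2 ℕ.^ (k ℕ.+ 1) ℕ.* k ℕ.+ 2 ℕ.^ k) * P k x
    ≡⟨ cong₂ (λ m p → ℕ→ℚ m * p) (trans (cong (λ e → 2 ℕ.^ e ℕ.* k ℕ.+ 2 ℕ.^ k) (ℕP.+-comm k 1)) (factor k (2 ℕ.^ k)))
                                  (P≡Q/2^k k x) ⟩
  ℕ→ℚ ((2 ℕ.* k ℕ.+ 1) ℕ.* 2 ℕ.^ k) * ((1 ÷ℕ (2 ℕ.^ k)) * Q k x)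
    ≡⟨ cong (_* ((1 ÷ℕ (2 ℕ.^ k)) * Q k x)) (ℕ→ℚ-homo-* (2 ℕ.* k ℕ.+ 1) (2 ℕ.^ k)) ⟩
  ℕ→ℚ (2 ℕ.* k ℕ.+ 1) * ℕ→ℚ (2 ℕ.^ k) * ((1 ÷ℕ (2 ℕ.^ k)) * Q k x)
    ≡⟨ regroup (ℕ→ℚ (2 ℕ.* k ℕ.+ 1)) (ℕ→ℚ (2 ℕ.^ k)) (1 ÷ℕ (2 ℕ.^ k)) (Q k x) ⟩
  ℕ→ℚ (2 ℕ.* k ℕ.+ 1) * ((1 ÷ℕ (2 ℕ.^ k)) * ℕ→ℚ (2 ℕ.^ k)) * Q k x
    ≡⟨ cong (λ u → ℕ→ℚ (2 ℕ.* k ℕ.+ 1) * u * Q k x) (÷ℕ-*-cancel 1 (2 ℕ.^ k) 2^k≢0) ⟩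
  ℕ→ℚ (2 ℕ.* k ℕ.+ 1) * 1ℚ * Q k x
    ≡⟨ cong (_* Q k x) (ℚP.*-identityʳ (ℕ→ℚ (2 ℕ.* k ℕ.+ 1))) ⟩
  ℕ→ℚ (2 ℕ.* k ℕ.+ 1) * Q k x ∎
  where
  open ≡-Reasoning
  factor : ∀ k p → 2 ℕ.* p ℕ.* k ℕ.+ p ≡ (2 ℕ.* k ℕ.+ 1) ℕ.* p
  factor = ℕ-Solver.solve-∀
  regroup : ∀ a p i q → a * p * (i * q) ≡ a * (i * p) * q
  regroup = solve-∀ ℚ-ring
  2^k≢0 : 2 ℕ.^ k ≢ 0
  2^k≢0 2^k≡0 = ℕP.<⇒≢ (ℕP.m^n>0 2 k) (sym 2^k≡0)

legendre-substitution : ∀ n x (T : ℕ → ℕ → ℚ) →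
  sumTo n (λ k → ℕ→ℚ (2 ℕ.^ (k ℕ.+ 1) ℕ.* k ℕ.+ 2 ℕ.^ k) * sumTo n (λ l → sumTo l (λ j → T l j * W j k)) * P k x)
  ≡ sumTo n (λ l → sumTo l (λ j → T l j * (half * x ^ j)))
legendre-substitution n x T = begin
  sumTo n (λ k → w k * sumTo n (λ l → sumTo l (λ j → T l j * W j k)) * P k x)
    ≡⟨ sumTo-cong n distribute ⟩
  sumTo n (λ k → sumTo n (λ l → sumTo l (λ j → T l j * V j k)))
    ≡⟨ sumTo-swap n n (λ k l → sumTo l (λ j → T l j * V j k)) ⟩
  sumTo n (λ l → sumTo n (λ k → sumTo l (λ j → T l j * V j k)))
    ≡⟨ sumTo-cong≤ n (λ l l≤n → trans (sumTo-swap n l (λ k j → T l j * V j k))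
                                      (sumTo-cong≤ l (λ j j≤l → expand l j (ℕP.≤-trans j≤l l≤n)))) ⟩
  sumTo n (λ l → sumTo l (λ j → T l j * (half * x ^ j))) ∎
  where
  open ≡-Reasoning
  w : ℕ → ℚ
  w k = ℕ→ℚ (2 ℕ.^ (k ℕ.+ 1) ℕ.* k ℕ.+ 2 ℕ.^ k)
  V : ℕ → ℕ → ℚ
  V j k = ℕ→ℚ (2 ℕ.* k ℕ.+ 1) * W j k * Q k x

  distribute : ∀ k → w k * sumTo n (λ l → sumTo l (λ j → T l j * W j k)) * P k x
                   ≡ sumTo n (λ l → sumTo l (λ j → T l j * V j k))
  distribute k = begin
    w k * Y * P k x                                       ≡⟨ regroup (w k) Y (P k x) ⟩
    Y * (w k * P k x)                                     ≡⟨ cong (Y *_) (legendreWeight*P≡[2k+1]*Q k x) ⟩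
    Y * (ℕ→ℚ (2 ℕ.* k ℕ.+ 1) * Q k x)
      ≡⟨ *-distribʳ-sumTo n (ℕ→ℚ (2 ℕ.* k ℕ.+ 1) * Q k x) (λ l → sumTo l (λ j → T l j * W j k)) ⟩
    sumTo n (λ l → sumTo l (λ j → T l j * W j k) * (ℕ→ℚ (2 ℕ.* k ℕ.+ 1) * Q k x))
      ≡⟨ sumTo-cong n (λ l → trans (*-distribʳ-sumTo l (ℕ→ℚ (2 ℕ.* k ℕ.+ 1) * Q k x) (λ j → T l j * W j k))
                                   (sumTo-cong l (λ j → regroup′ (T l j) (W j k) (ℕ→ℚ (2 ℕ.* k ℕ.+ 1)) (Q k x)))) ⟩
    sumTo n (λ l → sumTo l (λ j → T l j * V j k))         ∎
    where
    Y = sumTo n (λ l → sumTo l (λ j → T l j * W j k))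
    regroup : ∀ c y p → c * y * p ≡ y * (c * p)
    regroup = solve-∀ ℚ-ring
    regroup′ : ∀ t w a q → t * w * (a * q) ≡ t * (a * w * q)
    regroup′ = solve-∀ ℚ-ring

  expand : ∀ l j → j ≤ n → sumTo n (λ k → T l j * V j k) ≡ T l j * (half * x ^ j)
  expand l j j≤n = begin
    sumTo n (λ k → T l j * V j k)     ≡⟨ *-distribˡ-sumTo n (T l j) (V j) ⟨
    T l j * sumTo n (V j)             ≡⟨ cong (T l j *_) (sumTo-truncate n j≤n (λ k j<k → vanish k (W-< j<k))) ⟩
    T l j * legendreSum j x           ≡⟨ cong (T l j *_) (legendreSum≡half*x^j j x) ⟩
    T l j * (half * x ^ j)            ∎
    where
    vanish : ∀ k → W j k ≡ 0ℚ → V j k ≡ 0ℚ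
    vanish k c≡0 = trans (cong (λ c → ℕ→ℚ (2 ℕ.* k ℕ.+ 1) * c * Q k x) c≡0)
                           (trans (cong (_* Q k x) (ℚP.*-zeroʳ (ℕ→ℚ (2 ℕ.* k ℕ.+ 1)))) (ℚP.*-zeroˡ (Q k x)))

if-then-*-else-0 : ∀ b t w → (if b then t * w else 0ℚ) ≡ t * (if b then w else 0ℚ)
if-then-*-else-0 true  t w = refl
if-then-*-else-0 false t w = sym (ℚP.*-zeroʳ t)

theorem5 : (n : ℕ) (x : ℚ) →
    sumTo n (λ k → Epoly k x * Epoly (n ∸ k) x)
    ≡ (- (8 ÷ℕ (n ℕ.+ 2))) *
      sumTo n (λ k →
        ℕ→ℚ (2 ℕ.^ (k ℕ.+ 1) ℕ.* k ℕ.+ 2 ℕ.^ k) *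
        sumTo n (λ l →
          sumTo l (λ j →
            if does (k ≤? j) ∧ does ((j ∸ k) % 2 ℕ.≟ 0)
            then ℕ→ℚ ((n ℕ.+ 2) C l) * ℕ→ℚ (l C j) * E (n ∸ l ℕ.+ 1) * B (l ∸ j) *
                 ((j ! ℕ.* ((j ℕ.+ k ℕ.+ 2) / 2) !) ÷ℕ (((j ∸ k) / 2) ! ℕ.* (j ℕ.+ k ℕ.+ 2) !))
            else 0ℚ)) *
        P k x)
theorem5 n x = begin
  eulerConvolution n x
    ≡⟨ eulerConvolution≡R n x ⟩
  - (8 ÷ℕ (n ℕ.+ 2)) * sumTo n (λ l → sumTo l (λ j → R-term n l j * (half * x ^ j)))
    ≡⟨ cong (- (8 ÷ℕ (n ℕ.+ 2)) *_) (sym (legendre-substitution n x (R-term n))) ⟩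
  - (8 ÷ℕ (n ℕ.+ 2)) * sumTo n (λ k → ℕ→ℚ (2 ℕ.^ (k ℕ.+ 1) ℕ.* k ℕ.+ 2 ℕ.^ k) *
                          sumTo n (λ l → sumTo l (λ j → R-term n l j * W j k)) * P k x)
    ≡⟨ cong (- (8 ÷ℕ (n ℕ.+ 2)) *_) (sumTo-cong n (λ k → cong (λ s → ℕ→ℚ (2 ℕ.^ (k ℕ.+ 1) ℕ.* k ℕ.+ 2 ℕ.^ k) * s * P k x)
         (sumTo-cong n (λ l → sumTo-cong l (λ j → sym (if-then-*-else-0 _ (R-term n l j) _)))))) ⟩
  _ ∎
  where open ≡-Reasoning
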